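{- For every $n\ge2$, the abelian group $R^{ab}=R_{\mathrm{Heis}_n}/[R_{\mathrm{Heis}_n},R_{\mathrm{Heis}_n}]$ is generated as a $\mathbb{Z}[H_n]$-module by the classes of $a^n$, $b^n$, $[a,T]$, $[b,T]$. As a $\mathbb{Z}$-module it is generated by the following $n^3+1$ elements, where $k$ ranges over $0\le k\le n-1$: \[(a^n)^{\beta^i\tau^k},\ (b^n)^{\alpha^i\tau^k}\ (0\le i\le n-1);\qquad [a,T]^{\alpha^i\tau^k}\ (0\le i\le n-3),\ \text{and } [a,T]^{\alpha^{n-2}};\qquad [b,T]^{\alpha^i\beta^j\tau^k}\ (0\le i\le n-2,\ 0\le j\le n-3).\]
   Context: $F_2$ is the free group on $a,b$. For group elements, $[x,y]=xyx^{ -1}y^{ -1}$ and $x^y=yxy^{ -1}$; $T=[a,b]$. $H_n$ is the group of $3\times 3$ upper unitriangular matrices over $\mathbb{Z}/n\mathbb{Z}$, $\alpha$ (resp. $\beta$) the matrix with $1$ in position $(1,2)$ (resp. $(2,3)$), $\tau=[\alpha,\beta]$. $R_{\mathrm{Heis}_n}$ is the kernel of the surjection $F_2\to H_n$, $a\mapsto\alpha$, $b\mapsto\beta$ (equivalently the normal closure of $a^n,b^n,[a,T],[b,T]$). Conjugation by $F_2$ on $R^{ab}$ (written additively) factors through $H_n$; for $x\in R^{ab}$ and $h\in H_n$ write $x^h$ for this action, so $x^{gh}=(x^h)^g$. -}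

module Defs where

open import Data.Nat using (ℕ; zero; suc; _∸_)
open import Data.Integer using (ℤ; +_; -[1+_]; _+_; _*_; -_)
open import Data.Integer.Divisibility using (_∣_)
open import Data.Bool using (Bool; true; false; not)
open import Data.Product using (_×_; _,_; Σ; ∃)
open import Data.List using (List; []; _∷_; _++_; reverse; map; concatMap; upTo; foldr; replicate; concat)
open import Relation.Binary.PropositionalEquality using (_≡_)

data Gen2 : Set where
  ga gb : Gen2

-- a letter is a generator together with a flag: true = inverted
Letter : Set
Letter = Gen2 × Bool

flipL : Letter → Letter
flipL (g , e) = (g , not e)

Word : Set
Word = List Letter

data _≈ᶠ_ : Word → Word → Set where
  cancel : ∀ u x v → (u ++ x ∷ flipL x ∷ v) ≈ᶠ (u ++ v)
  ≈refl  : ∀ {u} → u ≈ᶠ u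
  ≈sym   : ∀ {u v} → u ≈ᶠ v → v ≈ᶠ u
  ≈trans : ∀ {u v w} → u ≈ᶠ v → v ≈ᶠ w → u ≈ᶠ w

infixl 7 _·_
_·_ : Word → Word → Word
u · v = u ++ v

inv : Word → Word
inv w = reverse (map flipL w)

a b : Word
a = (ga , false) ∷ []
b = (gb , false) ∷ []

comm : Word → Word → Word
comm x y = x · y · inv x · inv y

-- x^y = y x y⁻¹
conj : Word → Word → Word
conj x y = y · x · inv y

powℕ : Word → ℕ → Word
powℕ w m = concat (replicate m w)

powℤ : Word → ℤ → Word
powℤ w (+ m)      = powℕ w m
powℤ w -[1+ m ]   = powℕ (inv w) (suc m)

T : Word
T = comm a b

prodW : List Word → Word
prodW = foldr _·_ []

-- An upper unitriangular 3×3 matrix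
--   [[1,x,z],[0,1,y],[0,0,1]]  is recorded as (x , y , z);
-- we compute over ℤ (the integral Heisenberg group) and reduce mod n,
-- which is a homomorphism onto Hₙ.

Heis : Set
Heis = ℤ × ℤ × ℤ

_⊗_ : Heis → Heis → Heis
(x , y , z) ⊗ (x' , y' , z') = (x + x' , y + y' , z + z' + x * y')

letterH : Letter → Heis
letterH (ga , false) = (+ 1 , + 0 , + 0)
letterH (ga , true)  = (- + 1 , + 0 , + 0)
letterH (gb , false) = (+ 0 , + 1 , + 0)
letterH (gb , true)  = (+ 0 , - + 1 , + 0)

evalH : Word → Heis
evalH []      = (+ 0 , + 0 , + 0)
evalH (l ∷ w) = letterH l ⊗ evalH w

InR : ℕ → Word → Set
InR n w with evalH w
... | (x , y , z) = ((+ n) ∣ x) × ((+ n) ∣ y) × ((+ n) ∣ z)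

data Subgrp (P : Word → Set) : Word → Set where
  base  : ∀ {w} → P w → Subgrp P w
  unit  : Subgrp P []
  mul   : ∀ {u v} → Subgrp P u → Subgrp P v → Subgrp P (u · v)
  inver : ∀ {u} → Subgrp P u → Subgrp P (inv u)
  resp  : ∀ {u v} → u ≈ᶠ v → Subgrp P u → Subgrp P v

IsRComm : ℕ → Word → Set
IsRComm n w = Σ Word λ r → Σ Word λ s → InR n r × InR n s × (w ≡ comm r s)

-- u ≡ v modulo [R,R]  (for u, v ∈ R this is equality in R^ab)
_≡[RR_]_ : Word → ℕ → Word → Set
u ≡[RR n ] v = Subgrp (IsRComm n) (u · inv v)

data Gen4 : Set where
  gAn gBn gaT gbT : Gen4

gen4 : ℕ → Gen4 → Word
gen4 n gAn = powℕ a n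
gen4 n gBn = powℕ b n
gen4 n gaT = comm a T
gen4 n gbT = comm b T

-- element of Z[Hₙ]·{generators}: a conjugate of a generator or of its
-- inverse, the conjugating element being any lift in F₂ of h ∈ Hₙ
modTerm : ℕ → Word × Gen4 × Bool → Word
modTerm n (u , g , false) = conj (gen4 n g) u
modTerm n (u , g , true)  = conj (inv (gen4 n g)) u

-- The n³+1 ℤ-module generators.  x^{αⁱβʲτᵏ} is realised as conjugation
-- by the lift aⁱ bʲ Tᵏ.

zGens : ℕ → List Word
zGens n =
     concatMap (λ i → map (λ k → conj (powℕ a n) (powℕ b i · powℕ T k)) (upTo n)) (upTo n)
  ++ concatMap (λ i → map (λ k → conj (powℕ b n) (powℕ a i · powℕ T k)) (upTo n)) (upTo n)
  ++ concatMap (λ i → map (λ k → conj (comm a T) (powℕ a i · powℕ T k)) (upTo n)) (upTo (n ∸ 2))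
  ++ (conj (comm a T) (powℕ a (n ∸ 2)) ∷ [])
  ++ concatMap (λ i → concatMap (λ j → map (λ k →
         conj (comm b T) (powℕ a i · powℕ b j · powℕ T k)) (upTo n)) (upTo (n ∸ 2))) (upTo (n ∸ 1))

zComb : List Word → List ℤ → Word
zComb []       _        = []
zComb (_ ∷ _)  []       = []
zComb (g ∷ gs) (c ∷ cs) = powℤ g c · zComb gs cs

-- Let S be the subgroup generated by the n³+1 listed elements together with [R,R].
-- Modulo [R,R], R acts trivially on itself by conjugation, so whether a conjugate r^v of
-- r ∈ R lies in S depends only on the image of v in Hₙ.  For r = aⁿ and bⁿ all these
-- conjugates are listed.  For [a,T] and [b,T] the missing ones are produced row by row in
-- Hₙ from identities in F₂: the expansion of [xᵐ, y] as a product of conjugates of [x, y],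
-- applied to aⁿ, bⁿ, (aᵇ)ⁿ, (bᵃ)ⁿ and Tⁿ, and one relation between conjugates of [a,T] and
-- [b,T].  Then S is normal, every word is Tᶻbʸaˣ modulo S, and for words in R all of
-- x, y, z are multiples of n, so R = S.  Since elements of R commute modulo [R,R], a
-- product of listed elements and their inverses is a ℤ-combination of them.

module Submission where

open import Defs

open import Data.Bool using (Bool; true; false; not) renaming (_≟_ to _≟ᵇ_)
open import Data.Empty using (⊥-elim)
open import Data.Integer as ℤ using (ℤ; +_; -[1+_]; _+_; _*_; -_; _-_)
open import Data.Integer.Divisibility using () renaming (_∣_ to _∣ᵤ_)
open import Data.Integer.Divisibility.Signed as DS using (_∣_; divides)
open import Data.Integer.DivMod using (_%ℕ_; _/ℕ_; n%ℕd<d; a≡a%ℕn+[a/ℕn]*n)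
import Data.Integer.Properties as ℤP
open import Data.Integer.Tactic.RingSolver using (solve-∀)
open import Data.List using (List; []; _∷_; _++_; reverse; map; replicate; length; concatMap; upTo)
open import Data.List.Membership.Propositional using (_∈_)
open import Data.List.Membership.Propositional.Properties using (∈-++⁺ˡ; ∈-++⁺ʳ; ∈-concatMap⁺; ∈-map⁺; ∈-upTo⁺)
open import Data.List.Properties
  using (++-assoc; ++-identityʳ; reverse-++; map-++; unfold-reverse; length-++; length-map; length-upTo; length-replicate)
open import Data.List.Relation.Unary.All using (All; []; _∷_)
import Data.List.Relation.Unary.All as All
import Data.List.Relation.Unary.All.Properties as All
open import Data.List.Relation.Unary.Any using (here; there)
import Data.List.Relation.Unary.Any as Any
open import Data.Nat as ℕ using (ℕ; zero; suc; _<_; _≤_; _^_; z≤n; s≤s)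
import Data.Nat.Divisibility as ℕ
import Data.Nat.Properties as ℕP
import Data.Nat.Tactic.RingSolver as ℕ-Solver
open import Data.Product using (_×_; _,_; Σ; proj₁; proj₂)
open import Data.Sum using (_⊎_; inj₁; inj₂)
open import Level using (0ℓ)
open import Relation.Binary.Bundles using (Setoid)
open import Relation.Binary.PropositionalEquality hiding (resp; J)
import Relation.Binary.Reasoning.Setoid
open import Relation.Nullary using (yes; no)

-- Words modulo free reduction

flipL-involutive : ∀ x → flipL (flipL x) ≡ x
flipL-involutive (g , false) = refl
flipL-involutive (g , true)  = refl

inv-++ : ∀ u v → inv (u ++ v) ≡ inv v ++ inv u
inv-++ u v = trans (cong reverse (map-++ flipL u v)) (reverse-++ (map flipL u) (map flipL v))

inv-involutive : ∀ u → inv (inv u) ≡ u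
inv-involutive []      = refl
inv-involutive (x ∷ u) = begin
  inv (inv (x ∷ u))                 ≡⟨ cong inv (inv-++ (x ∷ []) u) ⟩
  inv (inv u ++ flipL x ∷ [])       ≡⟨ inv-++ (inv u) (flipL x ∷ []) ⟩
  flipL (flipL x) ∷ inv (inv u)     ≡⟨ cong₂ _∷_ (flipL-involutive x) (inv-involutive u) ⟩
  x ∷ u                             ∎
  where open ≡-Reasoning

≈ᶠ-reflexive : ∀ {u v} → u ≡ v → u ≈ᶠ v
≈ᶠ-reflexive refl = ≈refl

≈ᶠ-inContext : ∀ {u v} w w' → u ≈ᶠ v → (w ++ u ++ w') ≈ᶠ (w ++ v ++ w')
≈ᶠ-inContext w w' (cancel u x v) =
  subst₂ _≈ᶠ_ (reassoc (x ∷ flipL x ∷ v)) (reassoc v) (cancel (w ++ u) x (v ++ w'))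
  where
  reassoc : ∀ s → (w ++ u) ++ s ++ w' ≡ w ++ (u ++ s) ++ w'
  reassoc s = trans (++-assoc w u _) (cong (w ++_) (sym (++-assoc u s w')))
≈ᶠ-inContext w w' ≈refl        = ≈refl
≈ᶠ-inContext w w' (≈sym p)     = ≈sym (≈ᶠ-inContext w w' p)
≈ᶠ-inContext w w' (≈trans p q) = ≈trans (≈ᶠ-inContext w w' p) (≈ᶠ-inContext w w' q)

·-congˡ : ∀ {u v} w → u ≈ᶠ v → (w · u) ≈ᶠ (w · v)
·-congˡ {u} {v} w p =
  subst₂ _≈ᶠ_ (cong (w ++_) (++-identityʳ u)) (cong (w ++_) (++-identityʳ v)) (≈ᶠ-inContext w [] p)

·-congʳ : ∀ {u v} w → u ≈ᶠ v → (u · w) ≈ᶠ (v · w)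
·-congʳ w p = ≈ᶠ-inContext [] w p

·-cong : ∀ {u v u' v'} → u ≈ᶠ u' → v ≈ᶠ v' → (u · v) ≈ᶠ (u' · v')
·-cong {v = v} {u' = u'} p q = ≈trans (·-congʳ v p) (·-congˡ u' q)

·-inverseʳ : ∀ u → (u · inv u) ≈ᶠ []
·-inverseʳ []      = ≈refl
·-inverseʳ (x ∷ u) =
  ≈trans (≈ᶠ-reflexive (cong (x ∷_) (trans (cong (u ++_) (inv-++ (x ∷ []) u)) (sym (++-assoc u (inv u) _)))))
    (≈trans (≈ᶠ-inContext (x ∷ []) (flipL x ∷ []) (·-inverseʳ u)) (cancel [] x []))

·-inverseˡ : ∀ u → (inv u · u) ≈ᶠ []
·-inverseˡ u = subst (λ v → (inv u · v) ≈ᶠ []) (inv-involutive u) (·-inverseʳ (inv u))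

inv-cong : ∀ {u v} → u ≈ᶠ v → inv u ≈ᶠ inv v
inv-cong (cancel u x v) =
  subst₂ _≈ᶠ_ (sym inv-lhs) (sym (inv-++ u v)) (cancel (inv v) (flipL (flipL x)) (inv u))
  where
  inv-lhs : inv (u ++ x ∷ flipL x ∷ v) ≡ inv v ++ flipL (flipL x) ∷ flipL (flipL (flipL x)) ∷ inv u
  inv-lhs = begin
    inv (u ++ x ∷ flipL x ∷ v)                         ≡⟨ inv-++ u (x ∷ flipL x ∷ v) ⟩
    inv (x ∷ flipL x ∷ v) ++ inv u                     ≡⟨ cong (_++ inv u) (inv-++ (x ∷ flipL x ∷ []) v) ⟩
    (inv v ++ flipL (flipL x) ∷ flipL x ∷ []) ++ inv u ≡⟨ cong (λ y → (inv v ++ flipL (flipL x) ∷ flipL y ∷ []) ++ inv u)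
                                                            (sym (flipL-involutive x)) ⟩
    (inv v ++ flipL (flipL x) ∷ flipL (flipL (flipL x)) ∷ []) ++ inv u ≡⟨ ++-assoc (inv v) _ (inv u) ⟩
    inv v ++ flipL (flipL x) ∷ flipL (flipL (flipL x)) ∷ inv u ∎
    where open ≡-Reasoning
inv-cong ≈refl        = ≈refl
inv-cong (≈sym p)     = ≈sym (inv-cong p)
inv-cong (≈trans p q) = ≈trans (inv-cong p) (inv-cong q)

≈ᶠ-setoid : Setoid 0ℓ 0ℓ
≈ᶠ-setoid = record
  { Carrier = Word ; _≈_ = _≈ᶠ_
  ; isEquivalence = record { refl = ≈refl ; sym = ≈sym ; trans = ≈trans } }

module ≈ᶠ-Reasoning = Relation.Binary.Reasoning.Setoid ≈ᶠ-setoid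

module WordSolver where

  infixl 7 _∙_
  infix 8 _⁻¹

  data Expr : Set where
    var : ℕ → Expr
    ε   : Expr
    _∙_ : Expr → Expr → Expr
    _⁻¹ : Expr → Expr

  conjᵉ commᵉ : Expr → Expr → Expr
  conjᵉ x y = y ∙ x ∙ y ⁻¹
  commᵉ x y = x ∙ y ∙ x ⁻¹ ∙ y ⁻¹

  -- Variables outside the environment denote the empty word.
  _‼_ : List Word → ℕ → Word
  []       ‼ _     = []
  (w ∷ ws) ‼ zero  = w
  (w ∷ ws) ‼ suc i = ws ‼ i

  ⟦_⟧ : Expr → List Word → Word
  ⟦ var i ⟧ ρ = ρ ‼ i
  ⟦ ε ⟧     ρ = []
  ⟦ e ∙ f ⟧ ρ = ⟦ e ⟧ ρ · ⟦ f ⟧ ρ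
  ⟦ e ⁻¹ ⟧  ρ = inv (⟦ e ⟧ ρ)

  NormalForm : Set
  NormalForm = List (ℕ × Bool)

  ⟦_⟧ₗ : ℕ × Bool → List Word → Word
  ⟦ i , false ⟧ₗ ρ = ρ ‼ i
  ⟦ i , true ⟧ₗ  ρ = inv (ρ ‼ i)

  ⟦_⟧ₙ : NormalForm → List Word → Word
  ⟦ [] ⟧ₙ     ρ = []
  ⟦ x ∷ xs ⟧ₙ ρ = ⟦ x ⟧ₗ ρ ++ ⟦ xs ⟧ₙ ρ

  cons : ℕ × Bool → NormalForm → NormalForm
  cons x [] = x ∷ []
  cons (i , s) ((j , t) ∷ ys) with i ℕ.≟ j | s ≟ᵇ not t
  ... | yes _ | yes _ = ys
  ... | _     | _     = (i , s) ∷ (j , t) ∷ ys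

  append : NormalForm → NormalForm → NormalForm
  append []       ys = ys
  append (x ∷ xs) ys = cons x (append xs ys)

  flipLetter : ℕ × Bool → ℕ × Bool
  flipLetter (i , s) = (i , not s)

  invert : NormalForm → NormalForm
  invert xs = reverse (map flipLetter xs)

  normalise : Expr → NormalForm
  normalise (var i) = (i , false) ∷ []
  normalise ε       = []
  normalise (e ∙ f) = append (normalise e) (normalise f)
  normalise (e ⁻¹)  = invert (normalise e)

  cancel-letter : ∀ i t ys ρ → ⟦ ys ⟧ₙ ρ ≈ᶠ (⟦ i , not t ⟧ₗ ρ ++ ⟦ i , t ⟧ₗ ρ ++ ⟦ ys ⟧ₙ ρ)
  cancel-letter i false ys ρ =
    ≈sym (≈trans (≈ᶠ-reflexive (sym (++-assoc (inv (ρ ‼ i)) (ρ ‼ i) _))) (·-congʳ (⟦ ys ⟧ₙ ρ) (·-inverseˡ (ρ ‼ i))))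
  cancel-letter i true ys ρ =
    ≈sym (≈trans (≈ᶠ-reflexive (sym (++-assoc (ρ ‼ i) (inv (ρ ‼ i)) _))) (·-congʳ (⟦ ys ⟧ₙ ρ) (·-inverseʳ (ρ ‼ i))))

  cons-sound : ∀ x ys ρ → ⟦ cons x ys ⟧ₙ ρ ≈ᶠ (⟦ x ⟧ₗ ρ ++ ⟦ ys ⟧ₙ ρ)
  cons-sound x [] ρ = ≈refl
  cons-sound (i , s) ((j , t) ∷ ys) ρ with i ℕ.≟ j | s ≟ᵇ not t
  ... | yes refl | yes refl = cancel-letter i t ys ρ
  ... | yes _    | no _     = ≈refl
  ... | no _     | _        = ≈refl

  append-sound : ∀ xs ys ρ → ⟦ append xs ys ⟧ₙ ρ ≈ᶠ (⟦ xs ⟧ₙ ρ ++ ⟦ ys ⟧ₙ ρ)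
  append-sound []       ys ρ = ≈refl
  append-sound (x ∷ xs) ys ρ =
    ≈trans (cons-sound x (append xs ys) ρ)
      (≈trans (·-congˡ (⟦ x ⟧ₗ ρ) (append-sound xs ys ρ)) (≈ᶠ-reflexive (sym (++-assoc (⟦ x ⟧ₗ ρ) _ _))))

  ⟦++⟧ₙ : ∀ xs ys ρ → ⟦ xs ++ ys ⟧ₙ ρ ≡ ⟦ xs ⟧ₙ ρ ++ ⟦ ys ⟧ₙ ρ
  ⟦++⟧ₙ []       ys ρ = refl
  ⟦++⟧ₙ (x ∷ xs) ys ρ = trans (cong (⟦ x ⟧ₗ ρ ++_) (⟦++⟧ₙ xs ys ρ)) (sym (++-assoc (⟦ x ⟧ₗ ρ) _ _))

  flipLetter-sound : ∀ x ρ → ⟦ flipLetter x ⟧ₗ ρ ≡ inv (⟦ x ⟧ₗ ρ)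
  flipLetter-sound (i , false) ρ = refl
  flipLetter-sound (i , true)  ρ = sym (inv-involutive (ρ ‼ i))

  invert-sound : ∀ xs ρ → ⟦ invert xs ⟧ₙ ρ ≡ inv (⟦ xs ⟧ₙ ρ)
  invert-sound []       ρ = refl
  invert-sound (x ∷ xs) ρ = begin
    ⟦ reverse (flipLetter x ∷ map flipLetter xs) ⟧ₙ ρ
      ≡⟨ cong (λ z → ⟦ z ⟧ₙ ρ) (unfold-reverse (flipLetter x) (map flipLetter xs)) ⟩
    ⟦ invert xs ++ flipLetter x ∷ [] ⟧ₙ ρ
      ≡⟨ ⟦++⟧ₙ (invert xs) _ ρ ⟩
    ⟦ invert xs ⟧ₙ ρ ++ ⟦ flipLetter x ⟧ₗ ρ ++ []
      ≡⟨ cong₂ _++_ (invert-sound xs ρ) (trans (++-identityʳ _) (flipLetter-sound x ρ)) ⟩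
    inv (⟦ xs ⟧ₙ ρ) ++ inv (⟦ x ⟧ₗ ρ)
      ≡⟨ sym (inv-++ (⟦ x ⟧ₗ ρ) _) ⟩
    inv (⟦ x ∷ xs ⟧ₙ ρ) ∎
    where open ≡-Reasoning

  normalise-sound : ∀ e ρ → ⟦ e ⟧ ρ ≈ᶠ ⟦ normalise e ⟧ₙ ρ
  normalise-sound (var i) ρ = ≈ᶠ-reflexive (sym (++-identityʳ (ρ ‼ i)))
  normalise-sound ε       ρ = ≈refl
  normalise-sound (e ∙ f) ρ =
    ≈trans (·-cong (normalise-sound e ρ) (normalise-sound f ρ)) (≈sym (append-sound (normalise e) (normalise f) ρ))
  normalise-sound (e ⁻¹)  ρ = ≈trans (inv-cong (normalise-sound e ρ)) (≈ᶠ-reflexive (sym (invert-sound (normalise e) ρ)))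

  prove : ∀ ρ e f → normalise e ≡ normalise f → ⟦ e ⟧ ρ ≈ᶠ ⟦ f ⟧ ρ
  prove ρ e f eq =
    ≈trans (normalise-sound e ρ) (≈trans (≈ᶠ-reflexive (cong (λ z → ⟦ z ⟧ₙ ρ) eq)) (≈sym (normalise-sound f ρ)))

open WordSolver using (var; ε; _∙_; _⁻¹; conjᵉ; commᵉ; prove)

-- Identities in the free group

conj-· : ∀ x y u → conj (x · y) u ≈ᶠ (conj x u · conj y u)
conj-· x y u = prove (x ∷ y ∷ u ∷ []) (conjᵉ (var 0 ∙ var 1) (var 2)) (conjᵉ (var 0) (var 2) ∙ conjᵉ (var 1) (var 2)) refl

conj-conj : ∀ x u v → conj (conj x v) u ≈ᶠ conj x (u · v)
conj-conj x u v = prove (x ∷ u ∷ v ∷ []) (conjᵉ (conjᵉ (var 0) (var 2)) (var 1)) (conjᵉ (var 0) (var 1 ∙ var 2)) refl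

conj-[] : ∀ u → conj [] u ≈ᶠ []
conj-[] u = prove (u ∷ []) (conjᵉ ε (var 0)) ε refl

conj-inv : ∀ x u → conj (inv x) u ≈ᶠ inv (conj x u)
conj-inv x u = prove (x ∷ u ∷ []) (conjᵉ (var 0 ⁻¹) (var 1)) (conjᵉ (var 0) (var 1) ⁻¹) refl

conj-comm : ∀ x y u → comm (conj x u) (conj y u) ≈ᶠ conj (comm x y) u
conj-comm x y u =
  prove (x ∷ y ∷ u ∷ []) (commᵉ (conjᵉ (var 0) (var 2)) (conjᵉ (var 1) (var 2))) (conjᵉ (commᵉ (var 0) (var 1)) (var 2)) refl

conj-congˡ : ∀ {x y} u → x ≈ᶠ y → conj x u ≈ᶠ conj y u
conj-congˡ u p = ·-congʳ (inv u) (·-congˡ u p)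

comm-congˡ : ∀ {x x'} y → x ≈ᶠ x' → comm x y ≈ᶠ comm x' y
comm-congˡ y p = ·-cong (·-cong (·-congʳ y p) (inv-cong p)) ≈refl

powℕ-sucʳ : ∀ w m → powℕ w (suc m) ≡ powℕ w m · w
powℕ-sucʳ w zero    = ++-identityʳ w
powℕ-sucʳ w (suc m) = trans (cong (w ++_) (powℕ-sucʳ w m)) (sym (++-assoc w (powℕ w m) w))

powℕ-+ : ∀ w p q → powℕ w (p ℕ.+ q) ≡ powℕ w p · powℕ w q
powℕ-+ w zero    q = refl
powℕ-+ w (suc p) q = trans (cong (w ++_) (powℕ-+ w p q)) (sym (++-assoc w (powℕ w p) _))

powℕ-* : ∀ w q m → powℕ w (q ℕ.* m) ≡ powℕ (powℕ w m) q
powℕ-* w zero    m = refl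
powℕ-* w (suc q) m = trans (powℕ-+ w m (q ℕ.* m)) (cong (powℕ w m ++_) (powℕ-* w q m))

powℕ-conj : ∀ x u m → powℕ (conj x u) m ≈ᶠ conj (powℕ x m) u
powℕ-conj x u zero    = ≈sym (conj-[] u)
powℕ-conj x u (suc m) = ≈trans (·-congˡ (conj x u) (powℕ-conj x u m)) (≈sym (conj-· x (powℕ x m) u))

conj-powℕ-absorb : ∀ x q w p → conj (powℕ x q) (w · powℕ x p) ≈ᶠ conj (powℕ x q) w
conj-powℕ-absorb x q w p = ≈trans (≈sym (conj-conj (powℕ x q) w (powℕ x p))) (conj-congˡ w powers-commute)
  where
  powers-commute : conj (powℕ x q) (powℕ x p) ≈ᶠ powℕ x q
  powers-commute = begin
    powℕ x p · powℕ x q · inv (powℕ x p)   ≡⟨ cong (_· inv (powℕ x p)) (trans (sym (powℕ-+ x p q))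
                                                (trans (cong (powℕ x) (ℕP.+-comm p q)) (powℕ-+ x q p))) ⟩
    powℕ x q · powℕ x p · inv (powℕ x p)
      ≈⟨ prove (powℕ x q ∷ powℕ x p ∷ []) (var 0 ∙ var 1 ∙ var 1 ⁻¹) (var 0) refl ⟩
    powℕ x q                               ∎
    where open ≈ᶠ-Reasoning

conj-comm-powℕ-sucˡ : ∀ x y u m →
  conj (comm (powℕ x (suc m)) y) u ≈ᶠ (conj (comm x y) (u · powℕ x m) · conj (comm (powℕ x m) y) u)
conj-comm-powℕ-sucˡ x y u m rewrite powℕ-sucʳ x m =
  prove (x ∷ y ∷ u ∷ powℕ x m ∷ [])
    (conjᵉ (commᵉ (var 3 ∙ var 0) (var 1)) (var 2))
    (conjᵉ (commᵉ (var 0) (var 1)) (var 2 ∙ var 3) ∙ conjᵉ (commᵉ (var 3) (var 1)) (var 2)) refl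

conj-comm-powℕ-sucʳ : ∀ x y u m →
  conj (comm x (powℕ y (suc m))) u ≈ᶠ (conj (comm x (powℕ y m)) u · conj (comm x y) (u · powℕ y m))
conj-comm-powℕ-sucʳ x y u m rewrite powℕ-sucʳ y m =
  prove (x ∷ y ∷ u ∷ powℕ y m ∷ [])
    (conjᵉ (commᵉ (var 0) (var 3 ∙ var 1)) (var 2))
    (conjᵉ (commᵉ (var 0) (var 3)) (var 2) ∙ conjᵉ (commᵉ (var 0) (var 1)) (var 2 ∙ var 3)) refl

-- Both expand into conjugates of [a,T] resp. [b,T]; for m = n they link Tⁿ to aⁿ resp. bⁿ.
W V : ℕ → Word
W m = comm (powℕ a m) b · inv (powℕ T m)
V m = comm a (powℕ b m) · inv (powℕ T m)

conj-W-suc : ∀ m u → conj (W (suc m)) u ≈ᶠ (conj (W m) (u · a) · conj (comm a (powℕ T m)) u)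
conj-W-suc m u =
  ≈trans (conj-congˡ u (≈ᶠ-reflexive (cong (λ t → comm (powℕ a (suc m)) b · inv t) (powℕ-sucʳ T m))))
    (prove (a ∷ b ∷ u ∷ powℕ a m ∷ powℕ T m ∷ [])
    (conjᵉ (commᵉ (var 0 ∙ var 3) (var 1) ∙ (var 4 ∙ commᵉ (var 0) (var 1)) ⁻¹) (var 2))
    (conjᵉ (commᵉ (var 3) (var 1) ∙ var 4 ⁻¹) (var 2 ∙ var 0) ∙ conjᵉ (commᵉ (var 0) (var 4)) (var 2)) refl)

conj-V-suc : ∀ m u → conj (V (suc m)) u ≈ᶠ (conj (V m) u · conj (comm (powℕ b m) T) (u · powℕ T m))
conj-V-suc m u =
  ≈trans (conj-congˡ u (≈ᶠ-reflexive (cong₂ (λ s t → comm a s · inv t) (powℕ-sucʳ b m) (powℕ-sucʳ T m))))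
    (prove (a ∷ b ∷ u ∷ powℕ b m ∷ powℕ T m ∷ [])
    (conjᵉ (commᵉ (var 0) (var 3 ∙ var 1) ∙ (var 4 ∙ commᵉ (var 0) (var 1)) ⁻¹) (var 2))
    (conjᵉ (commᵉ (var 0) (var 3) ∙ var 4 ⁻¹) (var 2) ∙ conjᵉ (commᵉ (var 3) (commᵉ (var 0) (var 1))) (var 2 ∙ var 4)) refl)

conj-W-split : ∀ m u → conj (W m) u ≈ᶠ (conj (comm (powℕ a m) b) u · inv (conj (powℕ T m) u))
conj-W-split m u =
  prove (comm (powℕ a m) b ∷ powℕ T m ∷ u ∷ [])
    (conjᵉ (var 0 ∙ var 1 ⁻¹) (var 2)) (conjᵉ (var 0) (var 2) ∙ conjᵉ (var 1) (var 2) ⁻¹) refl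

conj-V-split : ∀ m u → conj (V m) u ≈ᶠ (conj (comm a (powℕ b m)) u · inv (conj (powℕ T m) u))
conj-V-split m u =
  prove (comm a (powℕ b m) ∷ powℕ T m ∷ u ∷ [])
    (conjᵉ (var 0 ∙ var 1 ⁻¹) (var 2)) (conjᵉ (var 0) (var 2) ∙ conjᵉ (var 1) (var 2) ⁻¹) refl

comm-aᵇ-T : comm (conj a b) T ≈ᶠ conj (comm a T) (inv T)
comm-aᵇ-T = prove (a ∷ b ∷ []) (commᵉ (conjᵉ (var 0) (var 1)) (commᵉ (var 0) (var 1)))
                  (conjᵉ (commᵉ (var 0) (commᵉ (var 0) (var 1))) (commᵉ (var 0) (var 1) ⁻¹)) refl

comm-bᵃ-T : comm (conj b a) T ≈ᶠ conj (comm b T) T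
comm-bᵃ-T = prove (a ∷ b ∷ []) (commᵉ (conjᵉ (var 1) (var 0)) (commᵉ (var 0) (var 1)))
                  (conjᵉ (commᵉ (var 1) (commᵉ (var 0) (var 1))) (commᵉ (var 0) (var 1))) refl

XY-relation : ∀ u → (conj (inv (comm b T)) (u · T) · conj (inv (comm a T)) (u · (a · b · inv a)) ·
                     conj (comm b T) (u · a) · conj (comm a T) u) ≈ᶠ []
XY-relation u = prove (a ∷ b ∷ u ∷ [])
  (conjᵉ (Yᵉ ⁻¹) (var 2 ∙ Tᵉ) ∙ conjᵉ (Xᵉ ⁻¹) (var 2 ∙ (var 0 ∙ var 1 ∙ var 0 ⁻¹)) ∙
   conjᵉ Yᵉ (var 2 ∙ var 0) ∙ conjᵉ Xᵉ (var 2))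
  ε refl
  where
  Tᵉ = commᵉ (var 0) (var 1)
  Xᵉ = commᵉ (var 0) Tᵉ
  Yᵉ = commᵉ (var 1) Tᵉ

-- Subgroups generated by a predicate

module _ {P : Word → Set} where

  subgrp-trivial : ∀ {w} → w ≈ᶠ [] → Subgrp P w
  subgrp-trivial e = resp (≈sym e) unit

  subgrp-inv⁻¹ : ∀ {u} → Subgrp P (inv u) → Subgrp P u
  subgrp-inv⁻¹ {u} g = resp (≈ᶠ-reflexive (inv-involutive u)) (inver g)

  subgrp-cancel : ∀ {p x q} → Subgrp P (p · x · q) → Subgrp P p → Subgrp P q → Subgrp P x
  subgrp-cancel {p} {x} {q} g gp gq =
    resp (prove (p ∷ x ∷ q ∷ []) ((var 0 ⁻¹ ∙ (var 0 ∙ var 1 ∙ var 2)) ∙ var 2 ⁻¹) (var 1) refl)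
      (mul (mul (inver gp) g) (inver gq))

  subgrp-cancelʳ : ∀ {x q} → Subgrp P (x · q) → Subgrp P q → Subgrp P x
  subgrp-cancelʳ g gq = subgrp-cancel {p = []} g unit gq

  subgrp-cancelˡ : ∀ {p x} → Subgrp P (p · x) → Subgrp P p → Subgrp P x
  subgrp-cancelˡ {p} {x} g gp = subgrp-cancel (resp (≈ᶠ-reflexive (sym (++-identityʳ (p · x)))) g) gp unit

  subgrp-from-relation₂ : ∀ {t₁ t₂ t₃ t₄} → (t₁ · t₂ · t₃ · t₄) ≈ᶠ [] →
                          Subgrp P t₁ → Subgrp P t₃ → Subgrp P t₄ → Subgrp P t₂
  subgrp-from-relation₂ {t₁} {t₂} {t₃} {t₄} e g₁ g₃ g₄ =
    subgrp-cancel (resp (≈sym (≈trans (≈ᶠ-reflexive (sym (++-assoc (t₁ · t₂) t₃ t₄))) e)) unit) g₁ (mul g₃ g₄)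

  subgrp-from-relation₃ : ∀ {t₁ t₂ t₃ t₄} → (t₁ · t₂ · t₃ · t₄) ≈ᶠ [] →
                          Subgrp P t₁ → Subgrp P t₂ → Subgrp P t₄ → Subgrp P t₃
  subgrp-from-relation₃ e g₁ g₂ g₄ = subgrp-cancel (resp (≈sym e) unit) (mul g₁ g₂) g₄

  subgrp-conj-inv : ∀ {r} v → Subgrp P (conj r v) → Subgrp P (conj (inv r) v)
  subgrp-conj-inv {r} v g = resp (≈sym (conj-inv r v)) (inver g)

  subgrp-conj-inv⁻¹ : ∀ {r} v → Subgrp P (conj (inv r) v) → Subgrp P (conj r v)
  subgrp-conj-inv⁻¹ {r} v g = subgrp-inv⁻¹ (resp (conj-inv r v) g)

  subgrp-powℕ : ∀ {w} m → Subgrp P w → Subgrp P (powℕ w m)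
  subgrp-powℕ zero    g = unit
  subgrp-powℕ (suc m) g = mul g (subgrp-powℕ m g)

  subgrp-powℕ-∣ : ∀ {w m x} → m ℕ.∣ x → Subgrp P (powℕ w m) → Subgrp P (powℕ w x)
  subgrp-powℕ-∣ {w} {m} (ℕ.divides q refl) g = subst (Subgrp P) (sym (powℕ-* w q m)) (subgrp-powℕ q g)

  subgrp-mono : ∀ {Q : Word → Set} → (∀ {w} → P w → Q w) → ∀ {w} → Subgrp P w → Subgrp Q w
  subgrp-mono f (base p)  = base (f p)
  subgrp-mono f unit      = unit
  subgrp-mono f (mul g h) = mul (subgrp-mono f g) (subgrp-mono f h)
  subgrp-mono f (inver g) = inver (subgrp-mono f g)
  subgrp-mono f (resp e g) = resp e (subgrp-mono f g)

  subgrp-conj : (∀ {g} u → P g → Subgrp P (conj g u)) → ∀ {w} u → Subgrp P w → Subgrp P (conj w u)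
  subgrp-conj hP u (base p)          = hP u p
  subgrp-conj hP u unit              = subgrp-trivial (conj-[] u)
  subgrp-conj hP u (mul {x} {y} g h) = resp (≈sym (conj-· x y u)) (mul (subgrp-conj hP u g) (subgrp-conj hP u h))
  subgrp-conj hP u (inver {x} g)     = resp (≈sym (conj-inv x u)) (inver (subgrp-conj hP u g))
  subgrp-conj hP u (resp e g)        = resp (conj-congˡ u e) (subgrp-conj hP u g)

  conj-comm-powℕˡ-∈ : ∀ x y u m → (∀ p → p < m → Subgrp P (conj (comm x y) (u · powℕ x p))) →
                      Subgrp P (conj (comm (powℕ x m) y) u)
  conj-comm-powℕˡ-∈ x y u zero    h = subgrp-trivial (prove (y ∷ u ∷ []) (conjᵉ (commᵉ ε (var 0)) (var 1)) ε refl)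
  conj-comm-powℕˡ-∈ x y u (suc m) h =
    resp (≈sym (conj-comm-powℕ-sucˡ x y u m))
      (mul (h m (ℕP.n<1+n m)) (conj-comm-powℕˡ-∈ x y u m (λ p p<m → h p (ℕP.m<n⇒m<1+n p<m))))

  conj-comm-powℕʳ-∈ : ∀ x y u m → (∀ p → p < m → Subgrp P (conj (comm x y) (u · powℕ y p))) →
                      Subgrp P (conj (comm x (powℕ y m)) u)
  conj-comm-powℕʳ-∈ x y u zero    h = subgrp-trivial (prove (x ∷ u ∷ []) (conjᵉ (commᵉ (var 0) ε) (var 1)) ε refl)
  conj-comm-powℕʳ-∈ x y u (suc m) h =
    resp (≈sym (conj-comm-powℕ-sucʳ x y u m))
      (mul (conj-comm-powℕʳ-∈ x y u m (λ p p<m → h p (ℕP.m<n⇒m<1+n p<m))) (h m (ℕP.n<1+n m)))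

  conj-comm-powℕˡ-extract : ∀ x y u m q → q < m → Subgrp P (conj (comm (powℕ x m) y) u) →
                            (∀ p → p < m → p ≢ q → Subgrp P (conj (comm x y) (u · powℕ x p))) →
                            Subgrp P (conj (comm x y) (u · powℕ x q))
  conj-comm-powℕˡ-extract x y u (suc m) q q<1+m g h with ℕP.m≤n⇒m<n∨m≡n (ℕP.≤-pred q<1+m)
  ... | inj₂ refl =
    subgrp-cancelʳ (resp (conj-comm-powℕ-sucˡ x y u q) g)
      (conj-comm-powℕˡ-∈ x y u q (λ p p<q → h p (ℕP.m<n⇒m<1+n p<q) (ℕP.<⇒≢ p<q)))
  ... | inj₁ q<m =
    conj-comm-powℕˡ-extract x y u m q q<m
      (subgrp-cancelˡ (resp (conj-comm-powℕ-sucˡ x y u m) g) (h m (ℕP.n<1+n m) (ℕP.>⇒≢ q<m)))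
      (λ p p<m → h p (ℕP.m<n⇒m<1+n p<m))

  conj-W-∈ : ∀ m u → (∀ q l → 2 ℕ.+ (q ℕ.+ l) ≤ m → Subgrp P (conj (comm a T) (u · powℕ a q · powℕ T l))) →
             Subgrp P (conj (W m) u)
  conj-W-∈ zero    u h = subgrp-trivial (prove (b ∷ u ∷ []) (conjᵉ (commᵉ ε (var 0) ∙ ε ⁻¹) (var 1)) ε refl)
  conj-W-∈ (suc m) u h =
    resp (≈sym (conj-W-suc m u))
      (mul (conj-W-∈ m (u · a) (λ q l le →
              subst (λ v → Subgrp P (conj (comm a T) (v · powℕ T l))) (sym (++-assoc u a (powℕ a q))) (h (suc q) l (s≤s le))))
           (conj-comm-powℕʳ-∈ a T u m (λ p p<m →
              subst (λ v → Subgrp P (conj (comm a T) (v · powℕ T p))) (++-identityʳ u) (h 0 p (s≤s p<m)))))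

  conj-W-extract : ∀ d u → (∀ p l → p < d → Subgrp P (conj (comm a T) (u · powℕ a p · powℕ T l))) →
                   Subgrp P (conj (W (2 ℕ.+ d)) u) → Subgrp P (conj (comm a T) (u · powℕ a d))
  conj-W-extract zero u h g =
    subst (λ v → Subgrp P (conj (comm a T) v)) (sym (++-identityʳ u))
      (subst (λ x → Subgrp P (conj x u)) (cong (comm a) (++-identityʳ T))
        (subgrp-cancelˡ (resp (conj-W-suc 1 u) g) (subgrp-trivial (W₁-trivial (u · a)))))
    where
    W₁-trivial : ∀ v → conj (W 1) v ≈ᶠ []
    W₁-trivial v =
      prove (a ∷ b ∷ v ∷ []) (conjᵉ (commᵉ (var 0 ∙ ε) (var 1) ∙ (commᵉ (var 0) (var 1) ∙ ε) ⁻¹) (var 2)) ε refl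
  conj-W-extract (suc d) u h g =
    subst (λ v → Subgrp P (conj (comm a T) v)) (++-assoc u a (powℕ a d))
      (conj-W-extract d (u · a)
        (λ p l p<d → subst (λ v → Subgrp P (conj (comm a T) (v · powℕ T l))) (sym (++-assoc u a (powℕ a p)))
                       (h (suc p) l (s≤s p<d)))
        (subgrp-cancelʳ (resp (conj-W-suc (2 ℕ.+ d) u) g)
          (conj-comm-powℕʳ-∈ a T u (2 ℕ.+ d) (λ p _ →
            subst (λ v → Subgrp P (conj (comm a T) (v · powℕ T p))) (++-identityʳ u) (h 0 p (s≤s z≤n))))))

  conj-V-∈ : ∀ m u → (∀ l p → p < l → l < m → Subgrp P (conj (comm b T) (u · powℕ T l · powℕ b p))) →
             Subgrp P (conj (V m) u)
  conj-V-∈ zero    u h = subgrp-trivial (prove (a ∷ u ∷ []) (conjᵉ (commᵉ (var 0) ε ∙ ε ⁻¹) (var 1)) ε refl)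
  conj-V-∈ (suc m) u h =
    resp (≈sym (conj-V-suc m u))
      (mul (conj-V-∈ m u (λ l p p<l l<m → h l p p<l (ℕP.m<n⇒m<1+n l<m)))
           (conj-comm-powℕˡ-∈ b T (u · powℕ T m) m (λ p p<m → h m p p<m (ℕP.n<1+n m))))

  comm-powℕ-powℕ-∈ : ∀ x y i m → (∀ p l → p < i → l < m → Subgrp P (conj (comm x y) (powℕ x p · powℕ y l))) →
                     Subgrp P (comm (powℕ x i) (powℕ y m))
  comm-powℕ-powℕ-∈ x y i m h =
    resp (≈ᶠ-reflexive (++-identityʳ _))
      (conj-comm-powℕˡ-∈ x (powℕ y m) [] i (λ p p<i → conj-comm-powℕʳ-∈ x y (powℕ x p) m (λ l l<m → h p l p<i l<m)))

OrbitIn : (Word → Set) → Word → Set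
OrbitIn P r = ∀ v → Subgrp P (conj r v)

module _ {P : Word → Set} where

  orbitIn-∈ : ∀ {r} → OrbitIn P r → Subgrp P r
  orbitIn-∈ {r} h = resp (≈ᶠ-reflexive (++-identityʳ r)) (h [])

  orbitIn-conj : ∀ {r} w → OrbitIn P r → OrbitIn P (conj r w)
  orbitIn-conj {r} w h v = resp (≈sym (conj-conj r v w)) (h (v · w))

  orbitIn-inv : ∀ {r} → OrbitIn P r → OrbitIn P (inv r)
  orbitIn-inv {r} h v = resp (≈sym (conj-inv r v)) (inver (h v))

  orbitIn-commˡ : ∀ {r} y → OrbitIn P r → OrbitIn P (comm r y)
  orbitIn-commˡ {r} y h u =
    resp (prove (r ∷ u ∷ y ∷ [])
            (conjᵉ (var 0) (var 1) ∙ conjᵉ (var 0) (var 1 ∙ var 2) ⁻¹) (conjᵉ (commᵉ (var 0) (var 2)) (var 1)) refl)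
      (mul (h u) (inver (h (u · y))))

  orbitIn-commʳ : ∀ {r} x → OrbitIn P r → OrbitIn P (comm x r)
  orbitIn-commʳ {r} x h u =
    resp (prove (r ∷ u ∷ x ∷ [])
            (conjᵉ (var 0) (var 1 ∙ var 2) ∙ conjᵉ (var 0) (var 1) ⁻¹) (conjᵉ (commᵉ (var 2) (var 0)) (var 1)) refl)
      (mul (h (u · x)) (inver (h u)))

-- The integral Heisenberg group

≡³ : ∀ {x y z x' y' z' : ℤ} → x ≡ x' → y ≡ y' → z ≡ z' → (x , y , z) ≡ (x' , y' , z')
≡³ p q r = cong₂ _,_ p (cong₂ _,_ q r)

eH : Heis
eH = (+ 0 , + 0 , + 0)

invH : Heis → Heis
invH (x , y , z) = (- x , - y , - z + x * y)

⊗-identityˡ : ∀ h → eH ⊗ h ≡ h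
⊗-identityˡ (x , y , z) = ≡³ (ℤP.+-identityˡ x) (ℤP.+-identityˡ y) (identity y z)
  where
  identity : ∀ y z → + 0 + z + + 0 * y ≡ z
  identity = solve-∀

⊗-identityʳ : ∀ h → h ⊗ eH ≡ h
⊗-identityʳ (x , y , z) = ≡³ (ℤP.+-identityʳ x) (ℤP.+-identityʳ y) (identity x z)
  where
  identity : ∀ x z → z + + 0 + x * + 0 ≡ z
  identity = solve-∀

⊗-inverseˡ : ∀ h → invH h ⊗ h ≡ eH
⊗-inverseˡ (x , y , z) = ≡³ (ℤP.+-inverseˡ x) (ℤP.+-inverseˡ y) (identity x y z)
  where
  identity : ∀ x y z → - z + x * y + z + - x * y ≡ + 0
  identity = solve-∀

⊗-assoc : ∀ h₁ h₂ h₃ → (h₁ ⊗ h₂) ⊗ h₃ ≡ h₁ ⊗ (h₂ ⊗ h₃)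
⊗-assoc (x₁ , y₁ , z₁) (x₂ , y₂ , z₂) (x₃ , y₃ , z₃) =
  ≡³ (ℤP.+-assoc x₁ x₂ x₃) (ℤP.+-assoc y₁ y₂ y₃) (identity x₁ x₂ y₂ y₃ z₁ z₂ z₃)
  where
  identity : ∀ x₁ x₂ y₂ y₃ z₁ z₂ z₃ →
             z₁ + z₂ + x₁ * y₂ + z₃ + (x₁ + x₂) * y₃ ≡ z₁ + (z₂ + z₃ + x₂ * y₃) + x₁ * (y₂ + y₃)
  identity = solve-∀

invH-⊗ : ∀ h h' → invH (h ⊗ h') ≡ invH h' ⊗ invH h
invH-⊗ (x , y , z) (x' , y' , z') =
  ≡³ (neg-+ x x') (neg-+ y y') (identity x x' y y' z z')
  where
  identity : ∀ x x' y y' z z' →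
             - (z + z' + x * y') + (x + x') * (y + y') ≡ - z' + x' * y' + (- z + x * y) + - x' * - y
  identity = solve-∀
  neg-+ : ∀ x x' → - (x + x') ≡ - x' + - x
  neg-+ = solve-∀

⊗-inverseʳ : ∀ h → h ⊗ invH h ≡ eH
⊗-inverseʳ (x , y , z) = ≡³ (ℤP.+-inverseʳ x) (ℤP.+-inverseʳ y) (identity x y z)
  where
  identity : ∀ x y z → z + (- z + x * y) + x * - y ≡ + 0
  identity = solve-∀

evalH-· : ∀ u v → evalH (u · v) ≡ evalH u ⊗ evalH v
evalH-· []      v = sym (⊗-identityˡ (evalH v))
evalH-· (l ∷ u) v = trans (cong (letterH l ⊗_) (evalH-· u v)) (sym (⊗-assoc (letterH l) (evalH u) (evalH v)))

letterH-flipL : ∀ l → letterH (flipL l) ≡ invH (letterH l)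
letterH-flipL (ga , false) = refl
letterH-flipL (ga , true)  = refl
letterH-flipL (gb , false) = refl
letterH-flipL (gb , true)  = refl

evalH-inv : ∀ u → evalH (inv u) ≡ invH (evalH u)
evalH-inv []      = refl
evalH-inv (l ∷ u) = begin
  evalH (inv (l ∷ u))                        ≡⟨ cong evalH (inv-++ (l ∷ []) u) ⟩
  evalH (inv u · (flipL l ∷ []))             ≡⟨ evalH-· (inv u) _ ⟩
  evalH (inv u) ⊗ (letterH (flipL l) ⊗ eH)   ≡⟨ cong₂ _⊗_ (evalH-inv u) (trans (⊗-identityʳ _) (letterH-flipL l)) ⟩
  invH (evalH u) ⊗ invH (letterH l)          ≡⟨ sym (invH-⊗ (letterH l) (evalH u)) ⟩
  invH (evalH (l ∷ u))                       ∎
  where open ≡-Reasoning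

evalH-cong : ∀ {u v} → u ≈ᶠ v → evalH u ≡ evalH v
evalH-cong (cancel u x v) = begin
  evalH (u · (x ∷ flipL x ∷ v))                       ≡⟨ evalH-· u _ ⟩
  evalH u ⊗ (letterH x ⊗ (letterH (flipL x) ⊗ evalH v))
    ≡⟨ cong (λ g → evalH u ⊗ (letterH x ⊗ (g ⊗ evalH v))) (letterH-flipL x) ⟩
  evalH u ⊗ (letterH x ⊗ (invH (letterH x) ⊗ evalH v))
    ≡⟨ cong (evalH u ⊗_) (sym (⊗-assoc (letterH x) _ (evalH v))) ⟩
  evalH u ⊗ ((letterH x ⊗ invH (letterH x)) ⊗ evalH v)
    ≡⟨ cong (λ g → evalH u ⊗ (g ⊗ evalH v)) (⊗-inverseʳ (letterH x)) ⟩
  evalH u ⊗ (eH ⊗ evalH v)                              ≡⟨ cong (evalH u ⊗_) (⊗-identityˡ (evalH v)) ⟩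
  evalH u ⊗ evalH v                                     ≡⟨ sym (evalH-· u v) ⟩
  evalH (u · v)                                         ∎
  where open ≡-Reasoning
evalH-cong ≈refl        = refl
evalH-cong (≈sym p)     = sym (evalH-cong p)
evalH-cong (≈trans p q) = trans (evalH-cong p) (evalH-cong q)

evalH-powℤ : ∀ w {x y z} → evalH w ≡ (x , y , z) → x * y ≡ + 0 → ∀ k → evalH (powℤ w k) ≡ (k * x , k * y , k * z)
evalH-powℤ w {x} {y} {z} e xy≡0 (+ m) = evalH-powℕ m
  where
  expand : ∀ m x y z → z + m * z + x * (m * y) ≡ (+ 1 + m) * z + m * (x * y)
  expand = solve-∀
  evalH-powℕ : ∀ m → evalH (powℕ w m) ≡ (+ m * x , + m * y , + m * z)
  evalH-powℕ zero    = refl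
  evalH-powℕ (suc m) = begin
    evalH (w · powℕ w m)                           ≡⟨ evalH-· w (powℕ w m) ⟩
    evalH w ⊗ evalH (powℕ w m)                     ≡⟨ cong₂ _⊗_ e (evalH-powℕ m) ⟩
    (x , y , z) ⊗ (+ m * x , + m * y , + m * z)    ≡⟨ ≡³ (sym (ℤP.suc-* (+ m) x)) (sym (ℤP.suc-* (+ m) y)) (begin
      z + + m * z + x * (+ m * y)                    ≡⟨ expand (+ m) x y z ⟩
      + suc m * z + + m * (x * y)                    ≡⟨ cong (λ t → + suc m * z + + m * t) xy≡0 ⟩
      + suc m * z + + m * + 0                        ≡⟨ cong (λ t → + suc m * z + t) (ℤP.*-zeroʳ (+ m)) ⟩
      + suc m * z + + 0                              ≡⟨ ℤP.+-identityʳ _ ⟩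
      + suc m * z                                    ∎) ⟩
    (+ suc m * x , + suc m * y , + suc m * z)      ∎
    where open ≡-Reasoning
evalH-powℤ w {x} {y} {z} e xy≡0 -[1+ m ] =
  trans (evalH-powℤ (inv w) evalH-inv-w inv-xy≡0 (+ suc m)) (≡³ (neg-* x) (neg-* y) (neg-* z))
  where
  neg-*-neg : ∀ u v → u * - v ≡ - u * v
  neg-*-neg = solve-∀
  neg-* : ∀ v → + suc m * - v ≡ -[1+ m ] * v
  neg-* = neg-*-neg (+ suc m)
  evalH-inv-w : evalH (inv w) ≡ (- x , - y , - z)
  evalH-inv-w = trans (evalH-inv w) (trans (cong invH e) (≡³ refl refl (trans (cong (λ t → - z + t) xy≡0) (ℤP.+-identityʳ (- z)))))
  inv-xy≡0 : - x * - y ≡ + 0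
  inv-xy≡0 = trans (trans (neg-*-neg (- x) y) (cong (_* y) (ℤP.neg-involutive x))) xy≡0

evalH-aᵏ : ∀ k → evalH (powℤ a k) ≡ (k , + 0 , + 0)
evalH-aᵏ k = trans (evalH-powℤ a refl refl k) (≡³ (ℤP.*-identityʳ k) (ℤP.*-zeroʳ k) (ℤP.*-zeroʳ k))

evalH-bᵏ : ∀ k → evalH (powℤ b k) ≡ (+ 0 , k , + 0)
evalH-bᵏ k = trans (evalH-powℤ b refl refl k) (≡³ (ℤP.*-zeroʳ k) (ℤP.*-identityʳ k) (ℤP.*-zeroʳ k))

evalH-Tᵏ : ∀ k → evalH (powℤ T k) ≡ (+ 0 , + 0 , k)
evalH-Tᵏ k = trans (evalH-powℤ T refl refl k) (≡³ (ℤP.*-zeroʳ k) (ℤP.*-zeroʳ k) (ℤP.*-identityʳ k))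

evalH-·³ : ∀ u v w → evalH (u · v · w) ≡ (evalH u ⊗ evalH v) ⊗ evalH w
evalH-·³ u v w = trans (evalH-· (u · v) w) (cong (_⊗ evalH w) (evalH-· u v))

evalH-aᵏbʲTˡ : ∀ k j l → evalH (powℤ a k · powℤ b j · powℤ T l) ≡ (k , j , l + k * j)
evalH-aᵏbʲTˡ k j l = begin
  evalH (powℤ a k · powℤ b j · powℤ T l)                ≡⟨ evalH-·³ (powℤ a k) (powℤ b j) (powℤ T l) ⟩
  (evalH (powℤ a k) ⊗ evalH (powℤ b j)) ⊗ evalH (powℤ T l)
                                                        ≡⟨ cong₂ _⊗_ (cong₂ _⊗_ (evalH-aᵏ k) (evalH-bᵏ j)) (evalH-Tᵏ l) ⟩
  ((k , + 0 , + 0) ⊗ (+ 0 , j , + 0)) ⊗ (+ 0 , + 0 , l) ≡⟨ ≡³ (identityˣ k) (identityʸ j) (identityᶻ k j l) ⟩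
  (k , j , l + k * j)                                   ∎
  where
  open ≡-Reasoning
  identityˣ : ∀ k → k + + 0 + + 0 ≡ k
  identityˣ = solve-∀
  identityʸ : ∀ j → + 0 + j + + 0 ≡ j
  identityʸ = solve-∀
  identityᶻ : ∀ k j l → + 0 + + 0 + k * j + l + (k + + 0) * + 0 ≡ l + k * j
  identityᶻ = solve-∀

evalH-aᵏTˡbʲ : ∀ k l j → evalH (powℤ a k · powℤ T l · powℤ b j) ≡ (k , j , l + k * j)
evalH-aᵏTˡbʲ k l j = begin
  evalH (powℤ a k · powℤ T l · powℤ b j)                ≡⟨ evalH-·³ (powℤ a k) (powℤ T l) (powℤ b j) ⟩
  (evalH (powℤ a k) ⊗ evalH (powℤ T l)) ⊗ evalH (powℤ b j)
                                                        ≡⟨ cong₂ _⊗_ (cong₂ _⊗_ (evalH-aᵏ k) (evalH-Tᵏ l)) (evalH-bᵏ j) ⟩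
  ((k , + 0 , + 0) ⊗ (+ 0 , + 0 , l)) ⊗ (+ 0 , j , + 0) ≡⟨ ≡³ (identityˣ k) (identityʸ j) (identityᶻ k j l) ⟩
  (k , j , l + k * j)                                   ∎
  where
  open ≡-Reasoning
  identityˣ : ∀ k → k + + 0 + + 0 ≡ k
  identityˣ = solve-∀
  identityʸ : ∀ j → + 0 + + 0 + j ≡ j
  identityʸ = solve-∀
  identityᶻ : ∀ k j l → + 0 + l + k * + 0 + + 0 + (k + + 0) * j ≡ l + k * j
  identityᶻ = solve-∀

evalH-aᵏTˡ : ∀ k l → evalH (powℤ a k · powℤ T l) ≡ (k , + 0 , l)
evalH-aᵏTˡ k l =
  trans (evalH-· (powℤ a k) (powℤ T l)) (trans (cong₂ _⊗_ (evalH-aᵏ k) (evalH-Tᵏ l)) (≡³ (ℤP.+-identityʳ k) refl (identity k l)))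
  where
  identity : ∀ k l → + 0 + l + k * + 0 ≡ l
  identity = solve-∀

evalH-bʲTˡ : ∀ j l → evalH (powℤ b j · powℤ T l) ≡ (+ 0 , j , l)
evalH-bʲTˡ j l =
  trans (evalH-· (powℤ b j) (powℤ T l)) (trans (cong₂ _⊗_ (evalH-bᵏ j) (evalH-Tᵏ l)) (≡³ refl (ℤP.+-identityʳ j) (identity l)))
  where
  identity : ∀ l → + 0 + l + + 0 * + 0 ≡ l
  identity = solve-∀

evalH-bʲTˡaᵏ : ∀ j l k → evalH (powℤ b j · powℤ T l · powℤ a k) ≡ (k , j , l)
evalH-bʲTˡaᵏ j l k = begin
  evalH (powℤ b j · powℤ T l · powℤ a k)                ≡⟨ evalH-·³ (powℤ b j) (powℤ T l) (powℤ a k) ⟩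
  (evalH (powℤ b j) ⊗ evalH (powℤ T l)) ⊗ evalH (powℤ a k)
                                                        ≡⟨ cong₂ _⊗_ (cong₂ _⊗_ (evalH-bᵏ j) (evalH-Tᵏ l)) (evalH-aᵏ k) ⟩
  ((+ 0 , j , + 0) ⊗ (+ 0 , + 0 , l)) ⊗ (k , + 0 , + 0) ≡⟨ ≡³ (identityˣ k) (identityʸ j) (identityᶻ j l) ⟩
  (k , j , l)                                           ∎
  where
  open ≡-Reasoning
  identityˣ : ∀ k → + 0 + + 0 + k ≡ k
  identityˣ = solve-∀
  identityʸ : ∀ j → j + + 0 + + 0 ≡ j
  identityʸ = solve-∀
  identityᶻ : ∀ j l → + 0 + l + + 0 * + 0 + + 0 + (+ 0 + + 0) * + 0 ≡ l
  identityᶻ = solve-∀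

evalH-[bᵃ]ᵏ : ∀ k → evalH (powℤ (conj b a) k) ≡ (+ 0 , k , k)
evalH-[bᵃ]ᵏ k = trans (evalH-powℤ (conj b a) refl refl k) (≡³ (ℤP.*-zeroʳ k) (ℤP.*-identityʳ k) (ℤP.*-identityʳ k))

evalH-[aᵇ]ᵏ : ∀ k → evalH (powℤ (conj a b) k) ≡ (k , + 0 , - k)
evalH-[aᵇ]ᵏ k = trans (evalH-powℤ (conj a b) refl refl k) (≡³ (ℤP.*-identityʳ k) (ℤP.*-zeroʳ k) (identity k))
  where
  identity : ∀ k → k * - + 1 ≡ - k
  identity = solve-∀

liftH : Heis → Word
liftH (x , y , z) = powℤ T z · powℤ b y · powℤ a x

evalH-liftH : ∀ h → evalH (liftH h) ≡ h
evalH-liftH (x , y , z) = begin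
  evalH (powℤ T z · powℤ b y · powℤ a x)           ≡⟨ evalH-·³ (powℤ T z) (powℤ b y) (powℤ a x) ⟩
  (evalH (powℤ T z) ⊗ evalH (powℤ b y)) ⊗ evalH (powℤ a x)
                                                   ≡⟨ cong₂ _⊗_ (cong₂ _⊗_ (evalH-Tᵏ z) (evalH-bᵏ y)) (evalH-aᵏ x) ⟩
  ((+ 0 , + 0 , z) ⊗ (+ 0 , y , + 0)) ⊗ (x , + 0 , + 0) ≡⟨ ≡³ (ℤP.+-identityˡ x) (identityʸ y) (identityᶻ y z) ⟩
  (x , y , z)                                      ∎
  where
  open ≡-Reasoning
  identityʸ : ∀ y → + 0 + y + + 0 ≡ y
  identityʸ = solve-∀
  identityᶻ : ∀ y z → z + + 0 + + 0 * y + + 0 + (+ 0 + + 0) * + 0 ≡ z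
  identityᶻ = solve-∀

signed : Word × Bool → Word
signed (g , false) = g
signed (g , true)  = inv g

prodSigned : List (Word × Bool) → Word
prodSigned L = prodW (map signed L)

invSigned : List (Word × Bool) → List (Word × Bool)
invSigned []            = []
invSigned ((g , s) ∷ L) = invSigned L ++ (g , not s) ∷ []

All-invSigned : ∀ {Q : Word → Set} {L} → All (λ p → Q (proj₁ p)) L → All (λ p → Q (proj₁ p)) (invSigned L)
All-invSigned []                           = []
All-invSigned {L = (g , s) ∷ L} (q ∷ qs) = All.++⁺ (All-invSigned qs) (q ∷ [])

prodW-++ : ∀ us vs → prodW (us ++ vs) ≡ prodW us · prodW vs
prodW-++ []       vs = refl
prodW-++ (u ∷ us) vs = trans (cong (u ++_) (prodW-++ us vs)) (sym (++-assoc u (prodW us) (prodW vs)))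

prodSigned-++ : ∀ L L' → prodSigned (L ++ L') ≡ prodSigned L · prodSigned L'
prodSigned-++ L L' = trans (cong prodW (map-++ signed L L')) (prodW-++ (map signed L) (map signed L'))

signed-flip : ∀ g s → signed (g , not s) ≈ᶠ inv (signed (g , s))
signed-flip g false = ≈refl
signed-flip g true  = ≈ᶠ-reflexive (sym (inv-involutive g))

prodSigned-invSigned : ∀ L → prodSigned (invSigned L) ≈ᶠ inv (prodSigned L)
prodSigned-invSigned []            = ≈refl
prodSigned-invSigned ((g , s) ∷ L) =
  ≈trans (≈ᶠ-reflexive (prodSigned-++ (invSigned L) ((g , not s) ∷ [])))
    (≈trans (·-cong (prodSigned-invSigned L) (≈trans (≈ᶠ-reflexive (++-identityʳ _)) (signed-flip g s)))
      (≈ᶠ-reflexive (sym (inv-++ (signed (g , s)) (prodSigned L)))))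

powℤ-suc : ∀ g c → powℤ g (ℤ.suc c) ≈ᶠ (g · powℤ g c)
powℤ-suc g (+ m)           = ≈refl
powℤ-suc g -[1+ zero ]     = ≈sym (≈trans (·-congˡ g (≈ᶠ-reflexive (++-identityʳ (inv g)))) (·-inverseʳ g))
powℤ-suc g -[1+ suc m ]    =
  ≈sym (≈trans (≈ᶠ-reflexive (sym (++-assoc g (inv g) _))) (·-congʳ (powℕ (inv g) (suc m)) (·-inverseʳ g)))

powℤ-pred : ∀ g c → powℤ g (ℤ.pred c) ≈ᶠ (inv g · powℤ g c)
powℤ-pred g (+ zero)  = ≈refl
powℤ-pred g (+ suc m) = ≈sym (≈trans (≈ᶠ-reflexive (sym (++-assoc (inv g) g _))) (·-congʳ (powℕ g m) (·-inverseˡ g)))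
powℤ-pred g -[1+ m ]  = ≈refl

zComb-zeros : ∀ gs → zComb gs (replicate (length gs) (+ 0)) ≡ []
zComb-zeros []       = refl
zComb-zeros (g ∷ gs) = zComb-zeros gs

∈-concatMap-upTo : ∀ {A : Set} (f : ℕ → List A) {m i x} → i < m → x ∈ f i → x ∈ concatMap f (upTo m)
∈-concatMap-upTo f i<m x∈fi = ∈-concatMap⁺ f (Any.map (λ { refl → x∈fi }) (∈-upTo⁺ i<m))

∈-map-upTo : ∀ {A : Set} (f : ℕ → A) {m k} → k < m → f k ∈ map f (upTo m)
∈-map-upTo f k<m = ∈-map⁺ f (∈-upTo⁺ k<m)

All-map : ∀ {A B : Set} {P : B → Set} {f : A → B} → (∀ x → P (f x)) → ∀ xs → All P (map f xs)
All-map h xs = All.map⁺ (All.universal h xs)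

All-concatMap : ∀ {A B : Set} {P : B → Set} {f : A → List B} → (∀ x → All P (f x)) → ∀ xs → All P (concatMap f xs)
All-concatMap h xs = All.concat⁺ (All.map⁺ (All.universal h xs))

length-concatMap : ∀ {A B : Set} (f : A → List B) k → (∀ x → length (f x) ≡ k) →
                   ∀ xs → length (concatMap f xs) ≡ length xs ℕ.* k
length-concatMap f k h []       = refl
length-concatMap f k h (x ∷ xs) = trans (length-++ (f x)) (cong₂ ℕ._+_ (h x) (length-concatMap f k h xs))

module Congruence (n : ℕ) where

  infix 4 _≡ₙ_ _≡ₕ_ _↦_ _~_

  -- Records rather than the underlying types, so that the related terms stay inferable.
  record _≡ₙ_ (x y : ℤ) : Set where
    constructor mk≡ₙ
    field n∣x-y : + n ∣ x - y

  ≡ₙ-reflexive : ∀ {x y} → x ≡ y → x ≡ₙ y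
  ≡ₙ-reflexive {x} refl = mk≡ₙ (divides (+ 0) (ℤP.+-inverseʳ x))

  ≡ₙ-refl : ∀ {x} → x ≡ₙ x
  ≡ₙ-refl = ≡ₙ-reflexive refl

  ≡ₙ-sym : ∀ {x y} → x ≡ₙ y → y ≡ₙ x
  ≡ₙ-sym {x} {y} (mk≡ₙ p) = mk≡ₙ (subst (+ n ∣_) (identity x y) (DS.∣m⇒∣-m p))
    where
    identity : ∀ x y → - (x - y) ≡ y - x
    identity = solve-∀

  ≡ₙ-trans : ∀ {x y z} → x ≡ₙ y → y ≡ₙ z → x ≡ₙ z
  ≡ₙ-trans {x} {y} {z} (mk≡ₙ p) (mk≡ₙ q) = mk≡ₙ (subst (+ n ∣_) (identity x y z) (DS.∣m∣n⇒∣m+n p q))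
    where
    identity : ∀ x y z → (x - y) + (y - z) ≡ x - z
    identity = solve-∀

  ≡ₙ-+ : ∀ {x x' y y'} → x ≡ₙ x' → y ≡ₙ y' → x + y ≡ₙ x' + y'
  ≡ₙ-+ {x} {x'} {y} {y'} (mk≡ₙ p) (mk≡ₙ q) = mk≡ₙ (subst (+ n ∣_) (identity x x' y y') (DS.∣m∣n⇒∣m+n p q))
    where
    identity : ∀ x x' y y' → (x - x') + (y - y') ≡ x + y - (x' + y')
    identity = solve-∀

  ≡ₙ-neg : ∀ {x x'} → x ≡ₙ x' → - x ≡ₙ - x'
  ≡ₙ-neg {x} {x'} (mk≡ₙ p) = mk≡ₙ (subst (+ n ∣_) (identity x x') (DS.∣m⇒∣-m p))
    where
    identity : ∀ x x' → - (x - x') ≡ - x - - x'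
    identity = solve-∀

  ≡ₙ-* : ∀ {x x' y y'} → x ≡ₙ x' → y ≡ₙ y' → x * y ≡ₙ x' * y'
  ≡ₙ-* {x} {x'} {y} {y'} (mk≡ₙ p) (mk≡ₙ q) =
    mk≡ₙ (subst (+ n ∣_) (identity x x' y y') (DS.∣m∣n⇒∣m+n (DS.∣m⇒∣m*n y p) (DS.∣n⇒∣m*n x' q)))
    where
    identity : ∀ x x' y y' → (x - x') * y + x' * (y - y') ≡ x * y - x' * y'
    identity = solve-∀

  record _≡ₕ_ (h h' : Heis) : Set where
    constructor mk≡ₕ
    field
      ≡ₙ₁ : proj₁ h ≡ₙ proj₁ h'
      ≡ₙ₂ : proj₁ (proj₂ h) ≡ₙ proj₁ (proj₂ h')
      ≡ₙ₃ : proj₂ (proj₂ h) ≡ₙ proj₂ (proj₂ h')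

  ≡ₕ-reflexive : ∀ {h h'} → h ≡ h' → h ≡ₕ h'
  ≡ₕ-reflexive refl = mk≡ₕ ≡ₙ-refl ≡ₙ-refl ≡ₙ-refl

  ≡ₕ-sym : ∀ {h h'} → h ≡ₕ h' → h' ≡ₕ h
  ≡ₕ-sym (mk≡ₕ p q r) = mk≡ₕ (≡ₙ-sym p) (≡ₙ-sym q) (≡ₙ-sym r)

  ≡ₕ-trans : ∀ {h h' h''} → h ≡ₕ h' → h' ≡ₕ h'' → h ≡ₕ h''
  ≡ₕ-trans (mk≡ₕ p q r) (mk≡ₕ p' q' r') = mk≡ₕ (≡ₙ-trans p p') (≡ₙ-trans q q') (≡ₙ-trans r r')

  ≡ₕ-⊗ : ∀ {h h' g g'} → h ≡ₕ h' → g ≡ₕ g' → h ⊗ g ≡ₕ h' ⊗ g'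
  ≡ₕ-⊗ (mk≡ₕ p q r) (mk≡ₕ p' q' r') = mk≡ₕ (≡ₙ-+ p p') (≡ₙ-+ q q') (≡ₙ-+ (≡ₙ-+ r r') (≡ₙ-* p q'))

  ≡ₕ-invH : ∀ {h h'} → h ≡ₕ h' → invH h ≡ₕ invH h'
  ≡ₕ-invH (mk≡ₕ p q r) = mk≡ₕ (≡ₙ-neg p) (≡ₙ-neg q) (≡ₙ-+ (≡ₙ-neg r) (≡ₙ-* p q))

  record _↦_ (v : Word) (h : Heis) : Set where
    constructor mk↦
    field evalH-≡ₕ : evalH v ≡ₕ h

  ↦-reflexive : ∀ {v h} → evalH v ≡ h → v ↦ h
  ↦-reflexive e = mk↦ (≡ₕ-reflexive e)

  ↦-evalH : ∀ v → v ↦ evalH v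
  ↦-evalH v = ↦-reflexive refl

  ↦-resp : ∀ {v h h'} → v ↦ h → h ≡ₕ h' → v ↦ h'
  ↦-resp (mk↦ p) q = mk↦ (≡ₕ-trans p q)

  ↦-≈ : ∀ {u v h} → u ≈ᶠ v → u ↦ h → v ↦ h
  ↦-≈ e (mk↦ p) = mk↦ (≡ₕ-trans (≡ₕ-reflexive (sym (evalH-cong e))) p)

  ↦-· : ∀ {u v h g} → u ↦ h → v ↦ g → u · v ↦ h ⊗ g
  ↦-· {u} {v} (mk↦ p) (mk↦ q) = mk↦ (≡ₕ-trans (≡ₕ-reflexive (evalH-· u v)) (≡ₕ-⊗ p q))

  ↦-inv : ∀ {u h} → u ↦ h → inv u ↦ invH h
  ↦-inv {u} (mk↦ p) = mk↦ (≡ₕ-trans (≡ₕ-reflexive (evalH-inv u)) (≡ₕ-invH p))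

  InR⇒↦eH : ∀ w → InR n w → w ↦ eH
  InR⇒↦eH w (p , q , r) = mk↦ (mk≡ₕ (divisible p) (divisible q) (divisible r))
    where
    divisible : ∀ {x} → + n ∣ᵤ x → x ≡ₙ + 0
    divisible {x} d = mk≡ₙ (subst (+ n ∣_) (sym (ℤP.+-identityʳ x)) (DS.∣ᵤ⇒∣ d))

  ↦eH⇒InR : ∀ w → w ↦ eH → InR n w
  ↦eH⇒InR w (mk↦ (mk≡ₕ p q r)) = divisible p , divisible q , divisible r
    where
    divisible : ∀ {x} → x ≡ₙ + 0 → + n ∣ᵤ x
    divisible {x} (mk≡ₙ d) = DS.∣⇒∣ᵤ (subst (+ n ∣_) (ℤP.+-identityʳ x) d)

  InR-[] : InR n []
  InR-[] = ↦eH⇒InR [] (↦-reflexive refl)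

  InR-· : ∀ u v → InR n u → InR n v → InR n (u · v)
  InR-· u v p q = ↦eH⇒InR (u · v) (↦-· (InR⇒↦eH u p) (InR⇒↦eH v q))

  InR-inv : ∀ u → InR n u → InR n (inv u)
  InR-inv u p = ↦eH⇒InR (inv u) (↦-inv (InR⇒↦eH u p))

  InR-≈ : ∀ {u v} → u ≈ᶠ v → InR n u → InR n v
  InR-≈ {u} {v} e p = ↦eH⇒InR v (↦-≈ e (InR⇒↦eH u p))

  InR-conj : ∀ r u → InR n r → InR n (conj r u)
  InR-conj r u p =
    ↦eH⇒InR (conj r u) (↦-resp (↦-· (↦-· (↦-evalH u) (InR⇒↦eH r p)) (↦-inv (↦-evalH u)))
                                (≡ₕ-reflexive (trans (cong (_⊗ invH g) (⊗-identityʳ g)) (⊗-inverseʳ g))))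
    where g = evalH u

  InR-comm : ∀ r s → InR n r → InR n s → InR n (comm r s)
  InR-comm r s p q = InR-· (r · s · inv r) (inv s) (InR-· (r · s) (inv r) (InR-· r s p q) (InR-inv r p)) (InR-inv s q)

  InR-powℕ : ∀ g m → InR n g → InR n (powℕ g m)
  InR-powℕ g zero    p = InR-[]
  InR-powℕ g (suc m) p = InR-· g (powℕ g m) p (InR-powℕ g m p)

  InR-powℤ : ∀ g k → InR n g → InR n (powℤ g k)
  InR-powℤ g (+ m)    p = InR-powℕ g m p
  InR-powℤ g -[1+ m ] p = InR-powℕ (inv g) (suc m) (InR-inv g p)

  RR : Word → Set
  RR = Subgrp (IsRComm n)

  IsRComm⇒InR : ∀ {w} → IsRComm n w → InR n w
  IsRComm⇒InR (r , s , p , q , refl) = InR-comm r s p q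

  Subgrp⇒InR : ∀ {Q : Word → Set} → (∀ {v} → Q v → InR n v) → ∀ {w} → Subgrp Q w → InR n w
  Subgrp⇒InR hQ (base q)          = hQ q
  Subgrp⇒InR hQ unit              = InR-[]
  Subgrp⇒InR hQ (mul {u} {v} g h) = InR-· u v (Subgrp⇒InR hQ g) (Subgrp⇒InR hQ h)
  Subgrp⇒InR hQ (inver {u} g)     = InR-inv u (Subgrp⇒InR hQ g)
  Subgrp⇒InR hQ (resp e g)        = InR-≈ e (Subgrp⇒InR hQ g)

  IsRComm-conj : ∀ {w} u → IsRComm n w → RR (conj w u)
  IsRComm-conj u (r , s , p , q , refl) = resp (conj-comm r s u) (base (conj r u , conj s u , InR-conj r u p , InR-conj s u q , refl))

  RR-conj : ∀ {w} u → RR w → RR (conj w u)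
  RR-conj = subgrp-conj IsRComm-conj

  record _~_ (u v : Word) : Set where
    constructor mk~
    field un~ : u ≡[RR n ] v
  open _~_ public

  ~-≈ : ∀ {u v} → u ≈ᶠ v → u ~ v
  ~-≈ {u} {v} e = mk~ (subgrp-trivial (≈trans (·-congʳ (inv v) e) (·-inverseʳ v)))

  ~-refl : ∀ {u} → u ~ u
  ~-refl = ~-≈ ≈refl

  ~-sym : ∀ {u v} → u ~ v → v ~ u
  ~-sym {u} {v} (mk~ p) = mk~ (resp (≈ᶠ-reflexive (trans (inv-++ u (inv v)) (cong (_++ inv u) (inv-involutive v)))) (inver p))

  ~-trans : ∀ {u v w} → u ~ v → v ~ w → u ~ w
  ~-trans {u} {v} {w} (mk~ p) (mk~ q) =
    mk~ (resp (prove (u ∷ v ∷ w ∷ []) ((var 0 ∙ var 1 ⁻¹) ∙ (var 1 ∙ var 2 ⁻¹)) (var 0 ∙ var 2 ⁻¹) refl) (mul p q))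

  ~-congˡ : ∀ {u v} w → u ~ v → w · u ~ w · v
  ~-congˡ {u} {v} w (mk~ p) =
    mk~ (resp (prove (u ∷ v ∷ w ∷ []) (conjᵉ (var 0 ∙ var 1 ⁻¹) (var 2)) ((var 2 ∙ var 0) ∙ (var 2 ∙ var 1) ⁻¹) refl)
              (RR-conj w p))

  ~-congʳ : ∀ {u v} w → u ~ v → u · w ~ v · w
  ~-congʳ {u} {v} w (mk~ p) =
    mk~ (resp (prove (u ∷ v ∷ w ∷ []) (var 0 ∙ var 1 ⁻¹) ((var 0 ∙ var 2) ∙ (var 1 ∙ var 2) ⁻¹) refl) p)

  ~-cong : ∀ {u v u' v'} → u ~ u' → v ~ v' → u · v ~ u' · v'
  ~-cong {v = v} {u' = u'} p q = ~-trans (~-congʳ v p) (~-congˡ u' q)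

  ~-inv : ∀ {u v} → u ~ v → inv u ~ inv v
  ~-inv {u} {v} (mk~ p) =
    mk~ (resp (prove (u ∷ v ∷ []) (conjᵉ ((var 0 ∙ var 1 ⁻¹) ⁻¹) (var 1 ⁻¹)) (var 0 ⁻¹ ∙ var 1 ⁻¹ ⁻¹) refl)
              (RR-conj (inv v) (inver p)))

  InR-commute : ∀ r s → InR n r → InR n s → r · s ~ s · r
  InR-commute r s p q =
    mk~ (resp (prove (r ∷ s ∷ []) (commᵉ (var 0) (var 1)) ((var 0 ∙ var 1) ∙ (var 1 ∙ var 0) ⁻¹) refl) (base (r , s , p , q , refl)))

  -- conj r v = conj (conj r (u⁻¹v)) u, and conj r (u⁻¹v) ~ r because u⁻¹v ∈ R.
  conj-reindex : ∀ {r u v h} → InR n r → u ↦ h → v ↦ h → conj r u ~ conj r v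
  conj-reindex {r} {u} {v} {h} pr pu pv =
    ~-sym (~-trans (~-≈ (prove (r ∷ u ∷ v ∷ []) (conjᵉ (var 0) (var 2)) (conjᵉ (conjᵉ (var 0) (var 1 ⁻¹ ∙ var 2)) (var 1)) refl))
                   (~-congʳ (inv u) (~-congˡ u (mk~ (base (ρ , r , InR-ρ , pr , refl))))))
    where
    ρ = inv u · v
    InR-ρ : InR n ρ
    InR-ρ = ↦eH⇒InR ρ (↦-resp (↦-· (↦-inv pu) pv) (≡ₕ-reflexive (⊗-inverseˡ h)))

  InR-signed : ∀ g s → InR n g → InR n (signed (g , s))
  InR-signed g false p = p
  InR-signed g true  p = InR-inv g p

  Flattening : (Word → Set) → Word → Set
  Flattening Q w = Σ (List (Word × Bool)) λ L → All (λ p → Q (proj₁ p)) L × (w ~ prodSigned L)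

  flatten : ∀ {Q w} → Subgrp (λ v → Q v ⊎ IsRComm n v) w → Flattening Q w
  flatten (base (inj₁ q)) = (_ , false) ∷ [] , q ∷ [] , ~-≈ (≈ᶠ-reflexive (sym (++-identityʳ _)))
  flatten {w = w} (base (inj₂ c)) = [] , [] , mk~ (resp (≈ᶠ-reflexive (sym (++-identityʳ w))) (base c))
  flatten unit = [] , [] , ~-refl
  flatten (mul g h) with flatten g | flatten h
  ... | L , qL , e | L' , qL' , e' =
    L ++ L' , All.++⁺ qL qL' , ~-trans (~-cong e e') (~-≈ (≈ᶠ-reflexive (sym (prodSigned-++ L L'))))
  flatten (inver g) with flatten g
  ... | L , qL , e = invSigned L , All-invSigned qL , ~-trans (~-inv e) (~-≈ (≈sym (prodSigned-invSigned L)))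
  flatten (resp e g) with flatten g
  ... | L , qL , e' = L , qL , ~-trans (~-sym (~-≈ e)) e'

  ZCombination : List Word → Word → Set
  ZCombination gs w = Σ (List ℤ) λ cs → length cs ≡ length gs × (w ~ zComb gs cs)

  add-generator : ∀ gs → All (InR n) gs → ∀ {g} → g ∈ gs → ∀ s cs → length cs ≡ length gs →
                  Σ (List ℤ) λ cs' → length cs' ≡ length gs × (signed (g , s) · zComb gs cs ~ zComb gs cs')
  add-generator (g ∷ gs) _ (here refl) false (c ∷ cs) e =
    ℤ.suc c ∷ cs , e ,
    ~-≈ (≈trans (≈ᶠ-reflexive (sym (++-assoc g (powℤ g c) _))) (·-congʳ (zComb gs cs) (≈sym (powℤ-suc g c))))
  add-generator (g ∷ gs) _ (here refl) true (c ∷ cs) e =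
    ℤ.pred c ∷ cs , e ,
    ~-≈ (≈trans (≈ᶠ-reflexive (sym (++-assoc (inv g) (powℤ g c) _))) (·-congʳ (zComb gs cs) (≈sym (powℤ-pred g c))))
  add-generator (g' ∷ gs) (p' ∷ ps) {g} (there g∈gs) s (c ∷ cs) e with add-generator gs ps g∈gs s cs (ℕP.suc-injective e)
  ... | cs' , e' , r =
    c ∷ cs' , cong suc e' ,
    ~-trans (~-≈ (≈ᶠ-reflexive (sym (++-assoc (signed (g , s)) (powℤ g' c) _))))
      (~-trans (~-congʳ (zComb gs cs)
                  (InR-commute (signed (g , s)) (powℤ g' c) (InR-signed g s (All.lookup ps g∈gs)) (InR-powℤ g' c p')))
        (~-trans (~-≈ (≈ᶠ-reflexive (++-assoc (powℤ g' c) (signed (g , s)) _))) (~-congˡ (powℤ g' c) r)))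
  add-generator (_ ∷ _) _ _ _ [] ()

  zCombination : ∀ gs → All (InR n) gs → ∀ L → All (λ p → proj₁ p ∈ gs) L → ZCombination gs (prodSigned L)
  zCombination gs pgs [] [] =
    replicate (length gs) (+ 0) , length-replicate (length gs) , ~-≈ (≈ᶠ-reflexive (sym (zComb-zeros gs)))
  zCombination gs pgs ((g , s) ∷ L) (g∈gs ∷ ps) with zCombination gs pgs L ps
  ... | cs , e , r with add-generator gs pgs g∈gs s cs e
  ... | cs' , e' , r' = cs' , e' , ~-trans (~-congˡ (signed (g , s)) r) r'

module Generation (n₀ : ℕ) where

  n : ℕ
  n = suc (suc n₀)

  open Congruence n

  A B X Y : Word
  A = powℕ a n
  B = powℕ b n
  X = comm a T
  Y = comm b T

  data Basis : Word → Set where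
    basisA  : ∀ {i k} → i < n → k < n → Basis (conj A (powℕ b i · powℕ T k))
    basisB  : ∀ {i k} → i < n → k < n → Basis (conj B (powℕ a i · powℕ T k))
    basisX  : ∀ {i k} → i < n₀ → k < n → Basis (conj X (powℕ a i · powℕ T k))
    basisX' : Basis (conj X (powℕ a n₀))
    basisY  : ∀ {i j k} → i < suc n₀ → j < n₀ → k < n → Basis (conj Y (powℕ a i · powℕ b j · powℕ T k))

  SpanGen : Word → Set
  SpanGen w = Basis w ⊎ IsRComm n w

  InSpan : Word → Set
  InSpan = Subgrp SpanGen

  InSpan-~ : ∀ {u v} → u ~ v → InSpan u → InSpan v
  InSpan-~ {u} {v} (mk~ p) g =
    resp (prove (u ∷ v ∷ []) ((var 0 ∙ var 1 ⁻¹) ⁻¹ ∙ var 0) (var 1) refl) (mul (inver (subgrp-mono inj₂ p)) g)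

  multiple-≡ₙ-0 : ∀ k → + n * k ≡ₙ + 0
  multiple-≡ₙ-0 k = mk≡ₙ (divides k (identity (+ n) k))
    where
    identity : ∀ m k → m * k - + 0 ≡ k * m
    identity = solve-∀

  InR-A : InR n A
  InR-A = ↦eH⇒InR A (↦-resp (↦-reflexive (evalH-powℤ a refl refl (+ n)))
                            (mk≡ₕ (multiple-≡ₙ-0 (+ 1)) (multiple-≡ₙ-0 (+ 0)) (multiple-≡ₙ-0 (+ 0))))

  InR-B : InR n B
  InR-B = ↦eH⇒InR B (↦-resp (↦-reflexive (evalH-powℤ b refl refl (+ n)))
                            (mk≡ₕ (multiple-≡ₙ-0 (+ 0)) (multiple-≡ₙ-0 (+ 1)) (multiple-≡ₙ-0 (+ 0))))

  InR-X : InR n X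
  InR-X = ↦eH⇒InR X (↦-evalH X)

  InR-Y : InR n Y
  InR-Y = ↦eH⇒InR Y (↦-evalH Y)

  residue : ∀ z → Σ ℕ λ k → k < n × + k ≡ₙ z
  residue z =
    z %ℕ n , n%ℕd<d z n , mk≡ₙ (divides (- (z /ℕ n)) (identity (+ (z %ℕ n)) (z /ℕ n) (+ n) z (a≡a%ℕn+[a/ℕn]*n z n)))
    where
    identity : ∀ r q m z → z ≡ r + q * m → r - z ≡ - q * m
    identity r q m z refl = solved r q m
      where
      solved : ∀ r q m → r - (r + q * m) ≡ - q * m
      solved = solve-∀

  OrbitAt : Word → Heis → Set
  OrbitAt r h = ∀ {v} → v ↦ h → InSpan (conj r v)

  orbitAt-resp : ∀ {r h h'} → h ≡ₕ h' → OrbitAt r h → OrbitAt r h'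
  orbitAt-resp e o pv = o (↦-resp pv (≡ₕ-sym e))

  orbitAt-intro : ∀ r {u h} → InR n r → u ↦ h → InSpan (conj r u) → OrbitAt r h
  orbitAt-intro r pr pu g pv = InSpan-~ (conj-reindex pr pu pv) g

  Cell : Word → ℤ → ℤ → Set
  Cell r x y = ∀ h → proj₁ h ≡ₙ x → proj₁ (proj₂ h) ≡ₙ y → OrbitAt r h

  Row : Word → ℤ → Set
  Row r x = ∀ h → proj₁ h ≡ₙ x → OrbitAt r h

  cell-from-residues : ∀ {r x y} c → (∀ k → k < n → OrbitAt r (x , y , + k + c)) → Cell r x y
  cell-from-residues c hk h px py with residue (proj₂ (proj₂ h) - c)
  ... | k , k<n , pk = orbitAt-resp (mk≡ₕ (≡ₙ-sym px) (≡ₙ-sym py) (shift pk)) (hk k k<n)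
    where
    shift : ∀ {k z} → k ≡ₙ z - c → k + c ≡ₙ z
    shift {k} {z} p = ≡ₙ-trans (≡ₙ-+ p (≡ₙ-refl {c})) (≡ₙ-reflexive (identity z c))
      where
      identity : ∀ z c → z - c + c ≡ z
      identity = solve-∀

  cell-from-residues₀ : ∀ {r x y} → (∀ k → k < n → OrbitAt r (x , y , + k)) → Cell r x y
  cell-from-residues₀ hk = cell-from-residues (+ 0) λ k k<n →
    orbitAt-resp (mk≡ₕ ≡ₙ-refl ≡ₙ-refl (≡ₙ-reflexive (sym (ℤP.+-identityʳ (+ k))))) (hk k k<n)

  cell-from-column : ∀ {r x y} → (∀ z → OrbitAt r (x , y , z)) → Cell r x y
  cell-from-column col h px py = orbitAt-resp (mk≡ₕ (≡ₙ-sym px) (≡ₙ-sym py) ≡ₙ-refl) (col (proj₂ (proj₂ h)))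

  row-from-cells : ∀ {r x} → (∀ y → y < n → Cell r x (+ y)) → Row r x
  row-from-cells hy h px with residue (proj₁ (proj₂ h))
  ... | y , y<n , py = hy y y<n h px (≡ₙ-sym py)

  orbitIn-from-rows : ∀ {r} → (∀ x → x < n → Row r (+ x)) → OrbitIn SpanGen r
  orbitIn-from-rows hx v with residue (proj₁ (evalH v))
  ... | x , x<n , px = hx x x<n (evalH v) (≡ₙ-sym px) (↦-evalH v)

  orbit-A : OrbitIn SpanGen A
  orbit-A = orbitIn-from-rows λ x x<n → row-from-cells λ y y<n → cell-from-residues₀ λ k k<n →
    orbitAt-intro A InR-A (↦-reflexive (evalH-bʲTˡaᵏ (+ y) (+ k) (+ x)))
      (resp (≈sym (conj-powℕ-absorb a n (powℕ b y · powℕ T k) x)) (base (inj₁ (basisA y<n k<n))))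

  orbit-B : OrbitIn SpanGen B
  orbit-B = orbitIn-from-rows λ x x<n → row-from-cells λ y y<n → cell-from-residues (+ x * + y) λ k k<n →
    orbitAt-intro B InR-B (↦-reflexive (evalH-aᵏTˡbʲ (+ x) (+ k) (+ y)))
      (resp (≈sym (conj-powℕ-absorb b n (powℕ a x · powℕ T k) y)) (base (inj₁ (basisB x<n k<n))))

  X-basis : ∀ {p} → p < n₀ → Cell X (+ p) (+ 0)
  X-basis {p} p<n₀ = cell-from-residues₀ λ k k<n →
    orbitAt-intro X InR-X (↦-reflexive (evalH-aᵏTˡ (+ p) (+ k))) (base (inj₁ (basisX p<n₀ k<n)))

  Y-basis : ∀ {i j} → i < suc n₀ → j < n₀ → Cell Y (+ i) (+ j)
  Y-basis {i} {j} i<1+n₀ j<n₀ = cell-from-residues (+ i * + j) λ k k<n →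
    orbitAt-intro Y InR-Y (↦-reflexive (evalH-aᵏbʲTˡ (+ i) (+ j) (+ k))) (base (inj₁ (basisY i<1+n₀ j<n₀ k<n)))

  split-<n : ∀ {p} → p < n → p < n₀ ⊎ p ≡ n₀ ⊎ p ≡ suc n₀
  split-<n (s≤s p≤1+n₀) with ℕP.m≤n⇒m<n∨m≡n p≤1+n₀
  ... | inj₂ p≡1+n₀       = inj₂ (inj₂ p≡1+n₀)
  ... | inj₁ (s≤s p≤n₀) with ℕP.m≤n⇒m<n∨m≡n p≤n₀
  ...   | inj₁ p<n₀ = inj₁ p<n₀
  ...   | inj₂ p≡n₀ = inj₂ (inj₁ p≡n₀)

  Tⁿ-∈ : InSpan (powℕ T n)
  Tⁿ-∈ = subgrp-inv⁻¹ (subgrp-cancelˡ (resp (≈ᶠ-reflexive (++-identityʳ (W n))) (conj-W-∈ n [] terms))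
                                      (orbitIn-∈ (orbitIn-commˡ b orbit-A)))
    where
    terms : ∀ q l → 2 ℕ.+ (q ℕ.+ l) ≤ n → InSpan (conj X (powℕ a q · powℕ T l))
    terms q zero (s≤s (s≤s q+0≤n₀)) with ℕP.m≤n⇒m<n∨m≡n (ℕP.m+n≤o⇒m≤o q q+0≤n₀)
    ... | inj₁ q<n₀ = base (inj₁ (basisX q<n₀ (s≤s z≤n)))
    ... | inj₂ refl = subst (λ v → InSpan (conj X v)) (sym (++-identityʳ (powℕ a n₀))) (base (inj₁ basisX'))
    terms q (suc l) (s≤s (s≤s q+1+l≤n₀)) =
      base (inj₁ (basisX (ℕP.<-≤-trans (ℕP.m<m+n q (s≤s z≤n)) q+1+l≤n₀)
                         (s≤s (ℕP.m≤n⇒m≤1+n (ℕP.m+n≤o⇒n≤o q q+1+l≤n₀)))))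

  Tⁿ-conj-∈ : ∀ x i → (∀ p l → p < i → l < n → InSpan (conj (comm x T) (powℕ x p · powℕ T l))) →
              InSpan (conj (powℕ T n) (powℕ x i))
  Tⁿ-conj-∈ x i h =
    resp (prove (powℕ x i ∷ powℕ T n ∷ []) (commᵉ (var 0) (var 1) ∙ var 1) (conjᵉ (var 1) (var 0)) refl)
      (mul (comm-powℕ-powℕ-∈ x T i n h) Tⁿ-∈)

  -- Row i ≤ n-2 of the orbit of [b,T].  Columns y < n-2 are listed; in column n-2 the
  -- relation from Vₙ yields one entry (top), [bⁿ,T] passes from column n-2 to n-1
  -- (raise), and [(bᵃ)ⁿ,T] together with raise lowers z by one (lower).
  module LowYRow (i : ℕ) (i≤n₀ : i < suc n₀) where

    I : ℤ
    I = + i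

    basis-cell : ∀ {j} → j < n₀ → Cell Y I (+ j)
    basis-cell = Y-basis i≤n₀

    Tⁿ-conj-aⁱ : InSpan (conj (powℕ T n) (powℕ a i))
    Tⁿ-conj-aⁱ = Tⁿ-conj-∈ a i λ p l p<i l<n → base (inj₁ (basisX (ℕP.<-≤-trans p<i (ℕP.≤-pred i≤n₀)) l<n))

    top : OrbitAt Y (I , + n₀ , + suc n₀ + I * + n₀)
    top = orbitAt-intro Y InR-Y (↦-reflexive (evalH-aᵏTˡbʲ I (+ suc n₀) (+ n₀)))
            (conj-comm-powℕˡ-extract b T u (suc n₀) n₀ (ℕP.n<1+n n₀) last-factor other-terms)
      where
      u = powℕ a i · powℕ T (suc n₀)
      basis-term : ∀ l {p} → p < n₀ → InSpan (conj Y (powℕ a i · powℕ T l · powℕ b p))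
      basis-term l {p} p<n₀ = basis-cell p<n₀ _ ≡ₙ-refl ≡ₙ-refl (↦-reflexive (evalH-aᵏTˡbʲ I (+ l) (+ p)))
      Vⁿ : InSpan (conj (V n) (powℕ a i))
      Vⁿ = resp (≈sym (conj-V-split n (powℕ a i))) (mul (orbitIn-commʳ a orbit-B (powℕ a i)) (inver Tⁿ-conj-aⁱ))
      Vⁿ⁻¹ : InSpan (conj (V (suc n₀)) (powℕ a i))
      Vⁿ⁻¹ = conj-V-∈ (suc n₀) (powℕ a i) λ l p p<l l<1+n₀ → basis-term l (ℕP.<-≤-trans p<l (ℕP.≤-pred l<1+n₀))
      last-factor : InSpan (conj (comm (powℕ b (suc n₀)) T) u)
      last-factor = subgrp-cancelˡ (resp (conj-V-suc (suc n₀) (powℕ a i)) Vⁿ) Vⁿ⁻¹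
      other-terms : ∀ p → p < suc n₀ → p ≢ n₀ → InSpan (conj Y (u · powℕ b p))
      other-terms p p<1+n₀ p≢n₀ = basis-term (suc n₀) (ℕP.≤∧≢⇒< (ℕP.≤-pred p<1+n₀) p≢n₀)

    module AtHeight (c : ℤ) where
      u : Word
      u = liftH (I , + 0 , c)

      u↦ : u ↦ (I , + 0 , c)
      u↦ = ↦-reflexive (evalH-liftH _)

      I+0≡I : I + + 0 ≡ₙ I
      I+0≡I = ≡ₙ-reflexive (ℤP.+-identityʳ I)

    raise : ∀ z → OrbitAt Y (I , + n₀ , z) → OrbitAt Y (I , + suc n₀ , z + I)
    raise z hz =
      orbitAt-intro Y InR-Y (↦-resp (u·bᵖ↦ (suc n₀)) (mk≡ₕ I+0≡I ≡ₙ-refl (≡ₙ-reflexive (identity₁ z I (+ n₀)))))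
        (conj-comm-powℕˡ-extract b T u n (suc n₀) (ℕP.n<1+n _) (orbitIn-commˡ T orbit-B u) terms)
      where
      open AtHeight (z - I * + n₀)
      identity₁ : ∀ z i m → z - i * m + + 0 + i * (+ 1 + m) ≡ z + i
      identity₁ = solve-∀
      identity₂ : ∀ z i m → z - i * m + + 0 + i * m ≡ z
      identity₂ = solve-∀
      u·bᵖ↦ : ∀ p → u · powℕ b p ↦ (I , + 0 , z - I * + n₀) ⊗ (+ 0 , + p , + 0)
      u·bᵖ↦ p = ↦-· u↦ (↦-reflexive (evalH-bᵏ (+ p)))
      terms : ∀ p → p < n → p ≢ suc n₀ → InSpan (conj Y (u · powℕ b p))
      terms p p<n p≢1+n₀ with split-<n p<n
      ... | inj₁ p<n₀        = basis-cell p<n₀ _ I+0≡I ≡ₙ-refl (u·bᵖ↦ p)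
      ... | inj₂ (inj₁ refl) = hz (↦-resp (u·bᵖ↦ n₀) (mk≡ₕ I+0≡I ≡ₙ-refl (≡ₙ-reflexive (identity₂ z I (+ n₀)))))
      ... | inj₂ (inj₂ p≡1+n₀) = ⊥-elim (p≢1+n₀ p≡1+n₀)

    lower : ∀ z → OrbitAt Y (I , + n₀ , z) → OrbitAt Y (I , + n₀ , z - + 1)
    lower z hz =
      orbitAt-intro Y InR-Y
        (↦-resp (u·[bᵃ]ᵖ·T↦ n₀) (mk≡ₕ I+0+0≡I (y-coord n₀) (mk≡ₙ (divides (+ 1) (identity₁ z I (+ n₀))))))
        (resp (as-Y n₀) (conj-comm-powℕˡ-extract (conj b a) T u n n₀ (ℕP.m<n⇒m<1+n (ℕP.n<1+n n₀)) full terms))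
      where
      open AtHeight (z - I * + n₀)
      identity₁ : ∀ z i m → z - i * m + m + i * m + + 1 + (i + + 0) * + 0 - (z - + 1) ≡ + 1 * (+ 2 + m)
      identity₁ = solve-∀
      identity₂ : ∀ z i m → z - i * m + (+ 1 + m) + i * (+ 1 + m) + + 1 + (i + + 0) * + 0 - (z + i) ≡ + 1 * (+ 2 + m)
      identity₂ = solve-∀
      identityˣ : ∀ i → i + + 0 + + 0 ≡ i
      identityˣ = solve-∀
      identityʸ : ∀ p → + 0 + p + + 0 ≡ p
      identityʸ = solve-∀
      I+0+0≡I : I + + 0 + + 0 ≡ₙ I
      I+0+0≡I = ≡ₙ-reflexive (identityˣ I)
      y-coord : ∀ p → + 0 + + p + + 0 ≡ₙ + p
      y-coord p = ≡ₙ-reflexive (identityʸ (+ p))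
      u·[bᵃ]ᵖ·T↦ : ∀ p → u · powℕ (conj b a) p · T ↦ ((I , + 0 , z - I * + n₀) ⊗ (+ 0 , + p , + p)) ⊗ (+ 0 , + 0 , + 1)
      u·[bᵃ]ᵖ·T↦ p = ↦-· (↦-· u↦ (↦-reflexive (evalH-[bᵃ]ᵏ (+ p)))) (↦-evalH T)
      as-Y : ∀ p → conj (comm (conj b a) T) (u · powℕ (conj b a) p) ≈ᶠ conj Y (u · powℕ (conj b a) p · T)
      as-Y p = ≈trans (conj-congˡ (u · powℕ (conj b a) p) comm-bᵃ-T) (conj-conj Y (u · powℕ (conj b a) p) T)
      full : InSpan (conj (comm (powℕ (conj b a) n) T) u)
      full = resp (conj-congˡ u (comm-congˡ T (≈sym (powℕ-conj b a n)))) (orbitIn-commˡ T (orbitIn-conj a orbit-B) u)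
      terms : ∀ p → p < n → p ≢ n₀ → InSpan (conj (comm (conj b a) T) (u · powℕ (conj b a) p))
      terms p p<n p≢n₀ with split-<n p<n
      ... | inj₁ p<n₀ = resp (≈sym (as-Y p)) (basis-cell p<n₀ _ I+0+0≡I (y-coord p) (u·[bᵃ]ᵖ·T↦ p))
      ... | inj₂ (inj₁ p≡n₀) = ⊥-elim (p≢n₀ p≡n₀)
      ... | inj₂ (inj₂ refl) =
        resp (≈sym (as-Y (suc n₀)))
          (raise z hz (↦-resp (u·[bᵃ]ᵖ·T↦ (suc n₀))
                                (mk≡ₕ I+0+0≡I (y-coord (suc n₀)) (mk≡ₙ (divides (+ 1) (identity₂ z I (+ n₀)))))))

    z₀ : ℤ
    z₀ = + suc n₀ + I * + n₀

    descend : ∀ d → OrbitAt Y (I , + n₀ , z₀ - + d)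
    descend zero    = orbitAt-resp (mk≡ₕ ≡ₙ-refl ≡ₙ-refl (≡ₙ-reflexive (sym (ℤP.+-identityʳ z₀)))) top
    descend (suc d) = orbitAt-resp (mk≡ₕ ≡ₙ-refl ≡ₙ-refl (≡ₙ-reflexive (identity z₀ (+ d)))) (lower _ (descend d))
      where
      identity : ∀ z d → z - d - + 1 ≡ z - (+ 1 + d)
      identity = solve-∀

    column-n₀ : ∀ z → OrbitAt Y (I , + n₀ , z)
    column-n₀ z with residue (z₀ - z)
    ... | d , _ , d≡z₀-z = orbitAt-resp (mk≡ₕ ≡ₙ-refl ≡ₙ-refl z₀-d≡z) (descend d)
      where
      identity : ∀ z₀ z → z₀ - (z₀ - z) ≡ z
      identity = solve-∀
      z₀-d≡z : z₀ - + d ≡ₙ z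
      z₀-d≡z = ≡ₙ-trans (≡ₙ-+ (≡ₙ-refl {z₀}) (≡ₙ-neg d≡z₀-z)) (≡ₙ-reflexive (identity z₀ z))

    row : Row Y I
    row = row-from-cells λ y y<n → cell (split-<n y<n)
      where
      identity : ∀ z i → z - i + i ≡ z
      identity = solve-∀
      cell : ∀ {y} → y < n₀ ⊎ y ≡ n₀ ⊎ y ≡ suc n₀ → Cell Y I (+ y)
      cell (inj₁ y<n₀)        = basis-cell y<n₀
      cell (inj₂ (inj₁ refl)) = cell-from-column column-n₀
      cell (inj₂ (inj₂ refl)) = cell-from-column λ z →
        orbitAt-resp (mk≡ₕ ≡ₙ-refl ≡ₙ-refl (≡ₙ-reflexive (identity z I))) (raise (z - I) (column-n₀ (z - I)))

  Y-row-low : ∀ i → i < suc n₀ → Row Y (+ i)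
  Y-row-low = LowYRow.row

  module XYRelation (h : Heis) where
    u : Word
    u = liftH h

    u↦ : u ↦ h
    u↦ = ↦-reflexive (evalH-liftH h)

    Y-term₁ : OrbitAt Y (h ⊗ evalH T) → InSpan (conj (inv Y) (u · T))
    Y-term₁ o = subgrp-conj-inv (u · T) (o (↦-· u↦ (↦-evalH T)))

    X-term₂ : OrbitAt X (h ⊗ evalH (a · b · inv a)) → InSpan (conj (inv X) (u · (a · b · inv a)))
    X-term₂ o = subgrp-conj-inv (u · (a · b · inv a)) (o (↦-· u↦ (↦-evalH (a · b · inv a))))

  X-from-XY-relation : ∀ h → OrbitAt Y (h ⊗ evalH T) → OrbitAt Y (h ⊗ evalH a) → OrbitAt X h →
                    OrbitAt X (h ⊗ evalH (a · b · inv a))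
  X-from-XY-relation h yτ yα x₀ =
    orbitAt-intro X InR-X (↦-· u↦ (↦-evalH (a · b · inv a)))
      (subgrp-conj-inv⁻¹ (u · (a · b · inv a))
        (subgrp-from-relation₂ (XY-relation u) (Y-term₁ yτ) (yα (↦-· u↦ (↦-evalH a))) (x₀ u↦)))
    where open XYRelation h

  Y-from-XY-relation : ∀ h → OrbitAt Y (h ⊗ evalH T) → OrbitAt X (h ⊗ evalH (a · b · inv a)) → OrbitAt X h →
                    OrbitAt Y (h ⊗ evalH a)
  Y-from-XY-relation h yτ xβ x₀ =
    orbitAt-intro Y InR-Y (↦-· u↦ (↦-evalH a))
      (subgrp-from-relation₃ (XY-relation u) (Y-term₁ yτ) (X-term₂ xβ) (x₀ u↦))
    where open XYRelation h

  X-row-low : ∀ p → p < n₀ → Row X (+ p)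
  X-row-low p p<n₀ = row-from-cells λ y _ → cell y
    where
    identity-suc : ∀ x → x + + 1 ≡ + 1 + x
    identity-suc = solve-∀
    identityᶻ : ∀ x z → z - x - + 1 + + 1 + x * + 1 ≡ z
    identityᶻ = solve-∀
    cell : ∀ j → Cell X (+ p) (+ j)
    cell zero = X-basis p<n₀
    cell (suc j) h' px py =
      orbitAt-resp (mk≡ₕ (≡ₙ-reflexive (ℤP.+-identityʳ x)) (≡ₙ-trans (≡ₙ-reflexive (identity-suc (+ j))) (≡ₙ-sym py))
                         (≡ₙ-reflexive (identityᶻ x z)))
        (X-from-XY-relation h
          (Y-row-low p (ℕP.m<n⇒m<1+n p<n₀) (h ⊗ evalH T) (≡ₙ-trans (≡ₙ-reflexive (ℤP.+-identityʳ x)) px))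
          (Y-row-low (suc p) (s≤s p<n₀) (h ⊗ evalH a) (≡ₙ-trans (≡ₙ-+ px ≡ₙ-refl) (≡ₙ-reflexive (identity-suc (+ p)))))
          (cell j h px ≡ₙ-refl))
      where
      x = proj₁ h'
      z = proj₂ (proj₂ h')
      h = (x , + j , z - x - + 1)

  -- Column j of rows n-2 and n-1 of the orbit of [a,T].  The relation from Wₙ yields z = 0
  -- in row n-2 (bottom), [aⁿ,T] passes from row n-2 to n-1 (raise), and [(aᵇ)ⁿ,T] together
  -- with raise increases z by one (step).
  module HighXRows (j : ℕ) where

    J : ℤ
    J = + j

    Tⁿ-conj-bʲ : InSpan (conj (powℕ T n) (powℕ b j))
    Tⁿ-conj-bʲ = Tⁿ-conj-∈ b j λ p l _ _ →
      Y-row-low 0 (s≤s z≤n) (+ 0 , + p , + l) ≡ₙ-refl (↦-reflexive (evalH-bʲTˡ (+ p) (+ l)))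

    bottom : InSpan (conj X (powℕ b j · powℕ a n₀))
    bottom = conj-W-extract n₀ (powℕ b j) terms Wⁿ
      where
      terms : ∀ p l → p < n₀ → InSpan (conj X (powℕ b j · powℕ a p · powℕ T l))
      terms p l p<n₀ =
        X-row-low p p<n₀ _ (≡ₙ-reflexive (ℤP.+-identityʳ (+ p)))
          (↦-· (↦-· (↦-reflexive (evalH-bᵏ J)) (↦-reflexive (evalH-aᵏ (+ p)))) (↦-reflexive (evalH-Tᵏ (+ l))))
      Wⁿ : InSpan (conj (W n) (powℕ b j))
      Wⁿ = resp (≈sym (conj-W-split n (powℕ b j))) (mul (orbitIn-commˡ b orbit-A (powℕ b j)) (inver Tⁿ-conj-bʲ))

    Column : ℤ → ℕ → Set
    Column x c = OrbitAt X (x , J , + c)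

    column₀-at-0 : Column (+ n₀) 0
    column₀-at-0 = orbitAt-intro X InR-X
      (↦-resp (↦-· (↦-reflexive (evalH-bᵏ J)) (↦-reflexive (evalH-aᵏ (+ n₀))))
              (mk≡ₕ ≡ₙ-refl (≡ₙ-reflexive (ℤP.+-identityʳ J)) (≡ₙ-reflexive (ℤP.*-zeroʳ (+ 0)))))
      bottom

    raise : ∀ c → Column (+ n₀) c → Column (+ suc n₀) c
    raise c hc = orbitAt-intro X InR-X (u·aᵖ↦ (suc n₀))
                   (conj-comm-powℕˡ-extract a T u n (suc n₀) (ℕP.n<1+n _) (orbitIn-commˡ T orbit-A u) terms)
      where
      u = powℕ b j · powℕ T c
      u·aᵖ↦ : ∀ p → u · powℕ a p ↦ (+ p , J , + c)
      u·aᵖ↦ p = ↦-reflexive (evalH-bʲTˡaᵏ J (+ c) (+ p))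
      terms : ∀ p → p < n → p ≢ suc n₀ → InSpan (conj X (u · powℕ a p))
      terms p p<n p≢1+n₀ with split-<n p<n
      ... | inj₁ p<n₀          = X-row-low p p<n₀ _ ≡ₙ-refl (u·aᵖ↦ p)
      ... | inj₂ (inj₁ refl)   = hc (u·aᵖ↦ n₀)
      ... | inj₂ (inj₂ p≡1+n₀) = ⊥-elim (p≢1+n₀ p≡1+n₀)

    step : ∀ c → Column (+ n₀) c → Column (+ n₀) (suc c)
    step c hc =
      orbitAt-intro X InR-X
        (↦-resp (u·[aᵇ]ᵖ·T⁻¹↦ n₀) (mk≡ₕ (x-coord n₀) J+0+0≡J (mk≡ₙ (divides (- + 1) (identity₁ (+ c) (+ n₀))))))
        (resp (as-X n₀) (conj-comm-powℕˡ-extract (conj a b) T u n n₀ (ℕP.m<n⇒m<1+n (ℕP.n<1+n n₀)) full terms))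
      where
      u = powℕ b j · powℕ T c
      identity₁ : ∀ c m → c + - m + + 0 * + 0 + - + 1 + (+ 0 + m) * + 0 - (+ 1 + c) ≡ - + 1 * (+ 2 + m)
      identity₁ = solve-∀
      identity₂ : ∀ c m → c + - (+ 1 + m) + + 0 * + 0 + - + 1 + (+ 0 + (+ 1 + m)) * + 0 - c ≡ - + 1 * (+ 2 + m)
      identity₂ = solve-∀
      identityʸ : ∀ j → j + + 0 + + 0 ≡ j
      identityʸ = solve-∀
      x-coord : ∀ p → + 0 + + p + + 0 ≡ₙ + p
      x-coord p = ≡ₙ-reflexive (ℤP.+-identityʳ (+ p))
      J+0+0≡J : J + + 0 + + 0 ≡ₙ J
      J+0+0≡J = ≡ₙ-reflexive (identityʸ J)
      u·[aᵇ]ᵖ·T⁻¹↦ : ∀ p → u · powℕ (conj a b) p · inv T ↦ ((+ 0 , J , + c) ⊗ (+ p , + 0 , - + p)) ⊗ (+ 0 , + 0 , - + 1)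
      u·[aᵇ]ᵖ·T⁻¹↦ p = ↦-· (↦-· (↦-reflexive (evalH-bʲTˡ J (+ c))) (↦-reflexive (evalH-[aᵇ]ᵏ (+ p)))) (↦-evalH (inv T))
      as-X : ∀ p → conj (comm (conj a b) T) (u · powℕ (conj a b) p) ≈ᶠ conj X (u · powℕ (conj a b) p · inv T)
      as-X p = ≈trans (conj-congˡ (u · powℕ (conj a b) p) comm-aᵇ-T) (conj-conj X (u · powℕ (conj a b) p) (inv T))
      full : InSpan (conj (comm (powℕ (conj a b) n) T) u)
      full = resp (conj-congˡ u (comm-congˡ T (≈sym (powℕ-conj a b n)))) (orbitIn-commˡ T (orbitIn-conj b orbit-A) u)
      terms : ∀ p → p < n → p ≢ n₀ → InSpan (conj (comm (conj a b) T) (u · powℕ (conj a b) p))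
      terms p p<n p≢n₀ with split-<n p<n
      ... | inj₁ p<n₀ = resp (≈sym (as-X p)) (X-row-low p p<n₀ _ (x-coord p) (u·[aᵇ]ᵖ·T⁻¹↦ p))
      ... | inj₂ (inj₁ p≡n₀) = ⊥-elim (p≢n₀ p≡n₀)
      ... | inj₂ (inj₂ refl) =
        resp (≈sym (as-X (suc n₀)))
          (raise c hc (↦-resp (u·[aᵇ]ᵖ·T⁻¹↦ (suc n₀))
                                (mk≡ₕ (x-coord (suc n₀)) J+0+0≡J (mk≡ₙ (divides (- + 1) (identity₂ (+ c) (+ n₀)))))))

    column₀ : ∀ c → Column (+ n₀) c
    column₀ zero    = column₀-at-0
    column₀ (suc c) = step c (column₀ c)

    cell₀ : Cell X (+ n₀) J
    cell₀ = cell-from-residues₀ λ k _ → column₀ k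

    cell₁ : Cell X (+ suc n₀) J
    cell₁ = cell-from-residues₀ λ k _ → raise k (column₀ k)

  X-row : ∀ x → x < n → Row X (+ x)
  X-row x x<n with split-<n x<n
  ... | inj₁ x<n₀        = X-row-low x x<n₀
  ... | inj₂ (inj₁ refl) = row-from-cells λ y _ → HighXRows.cell₀ y
  ... | inj₂ (inj₂ refl) = row-from-cells λ y _ → HighXRows.cell₁ y

  Y-row-top : Row Y (+ suc n₀)
  Y-row-top h' px =
    orbitAt-resp (mk≡ₕ (≡ₙ-reflexive (identityˣ x)) (≡ₙ-reflexive (ℤP.+-identityʳ y)) (≡ₙ-reflexive (identityᶻ x z)))
      (Y-from-XY-relation h
        (Y-row-low n₀ (ℕP.n<1+n n₀) (h ⊗ evalH T) (≡ₙ-trans (≡ₙ-reflexive (ℤP.+-identityʳ (x - + 1))) x-1≡n₀))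
        (X-row n₀ n₀<n (h ⊗ evalH (a · b · inv a)) (≡ₙ-trans (≡ₙ-reflexive (ℤP.+-identityʳ (x - + 1))) x-1≡n₀))
        (X-row n₀ n₀<n h x-1≡n₀))
    where
    x = proj₁ h'
    y = proj₁ (proj₂ h')
    z = proj₂ (proj₂ h')
    h = (x - + 1 , y , z)
    n₀<n : n₀ < n
    n₀<n = ℕP.m<n⇒m<1+n (ℕP.n<1+n n₀)
    identity-pred : ∀ m → + 1 + m - + 1 ≡ m
    identity-pred = solve-∀
    identityˣ : ∀ x → x - + 1 + + 1 ≡ x
    identityˣ = solve-∀
    identityᶻ : ∀ x z → z + + 0 + (x - + 1) * + 0 ≡ z
    identityᶻ = solve-∀
    x-1≡n₀ : x - + 1 ≡ₙ + n₀
    x-1≡n₀ = ≡ₙ-trans (≡ₙ-+ px ≡ₙ-refl) (≡ₙ-reflexive (identity-pred (+ n₀)))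

  orbit-X : OrbitIn SpanGen X
  orbit-X = orbitIn-from-rows X-row

  orbit-Y : OrbitIn SpanGen Y
  orbit-Y = orbitIn-from-rows λ y y<n → row (ℕP.m≤n⇒m<n∨m≡n (ℕP.≤-pred y<n))
    where
    row : ∀ {y} → y < suc n₀ ⊎ y ≡ suc n₀ → Row Y (+ y)
    row (inj₁ y≤n₀) = Y-row-low _ y≤n₀
    row (inj₂ refl) = Y-row-top

  generator-conj : ∀ {g} u → SpanGen g → InSpan (conj g u)
  generator-conj u (inj₁ (basisA {i} {k} _ _))       = orbitIn-conj (powℕ b i · powℕ T k) orbit-A u
  generator-conj u (inj₁ (basisB {i} {k} _ _))       = orbitIn-conj (powℕ a i · powℕ T k) orbit-B u
  generator-conj u (inj₁ (basisX {i} {k} _ _))       = orbitIn-conj (powℕ a i · powℕ T k) orbit-X u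
  generator-conj u (inj₁ basisX')                    = orbitIn-conj (powℕ a n₀) orbit-X u
  generator-conj u (inj₁ (basisY {i} {j} {k} _ _ _)) = orbitIn-conj (powℕ a i · powℕ b j · powℕ T k) orbit-Y u
  generator-conj u (inj₂ c)                          = subgrp-mono inj₂ (IsRComm-conj u c)

  InSpan-conj : ∀ {w} u → InSpan w → InSpan (conj w u)
  InSpan-conj = subgrp-conj generator-conj

  Basis⇒InR : ∀ {w} → Basis w → InR n w
  Basis⇒InR (basisA {i} {k} _ _)       = InR-conj A (powℕ b i · powℕ T k) InR-A
  Basis⇒InR (basisB {i} {k} _ _)       = InR-conj B (powℕ a i · powℕ T k) InR-B
  Basis⇒InR (basisX {i} {k} _ _)       = InR-conj X (powℕ a i · powℕ T k) InR-X
  Basis⇒InR basisX'                    = InR-conj X (powℕ a n₀) InR-X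
  Basis⇒InR (basisY {i} {j} {k} _ _ _) = InR-conj Y (powℕ a i · powℕ b j · powℕ T k) InR-Y

  InSpan⇒InR : ∀ {w} → InSpan w → InR n w
  InSpan⇒InR = Subgrp⇒InR λ { (inj₁ p) → Basis⇒InR p ; (inj₂ c) → IsRComm⇒InR c }

  HasNormalForm : Word → Set
  HasNormalForm u = Σ ℕ λ x → Σ ℕ λ y → Σ ℕ λ z → InSpan (u · inv (liftH (+ x , + y , + z)))

  normalForm-·a : ∀ u → HasNormalForm u → HasNormalForm (u · a)
  normalForm-·a u (x , y , z , g) = suc x , y , z , resp e g
    where
    e : (u · inv (powℕ T z · powℕ b y · powℕ a x)) ≈ᶠ (u · a · inv (powℕ T z · powℕ b y · powℕ a (suc x)))
    e = ≈trans (prove (u ∷ powℕ T z ∷ powℕ b y ∷ powℕ a x ∷ a ∷ [])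
                  (var 0 ∙ (var 1 ∙ var 2 ∙ var 3) ⁻¹) (var 0 ∙ var 4 ∙ (var 1 ∙ var 2 ∙ (var 3 ∙ var 4)) ⁻¹) refl)
               (≈ᶠ-reflexive (cong (λ t → u · a · inv (powℕ T z · powℕ b y · t)) (sym (powℕ-sucʳ a x))))

  W-∈ : ∀ m → InSpan (W m)
  W-∈ m = resp (≈ᶠ-reflexive (++-identityʳ (W m))) (conj-W-∈ m [] λ q l _ → orbit-X (powℕ a q · powℕ T l))

  normalForm-·b : ∀ u → HasNormalForm u → HasNormalForm (u · b)
  normalForm-·b u (x , y , z , g) =
    x , suc y , z ℕ.+ x ,
    resp e (mul g (mul (InSpan-conj (powℕ T z · powℕ b y) (W-∈ x))
                       (InSpan-conj (powℕ T z) (comm-powℕ-powℕ-∈ b T y x λ p l _ _ → orbit-Y (powℕ b p · powℕ T l)))))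
    where
    e : (u · inv (powℕ T z · powℕ b y · powℕ a x) ·
           (conj (W x) (powℕ T z · powℕ b y) · conj (comm (powℕ b y) (powℕ T x)) (powℕ T z)))
        ≈ᶠ (u · b · inv (powℕ T (z ℕ.+ x) · powℕ b (suc y) · powℕ a x))
    e = ≈trans (prove (u ∷ powℕ T z ∷ powℕ b y ∷ powℕ a x ∷ b ∷ powℕ T x ∷ [])
                  (var 0 ∙ (var 1 ∙ var 2 ∙ var 3) ⁻¹ ∙
                     (conjᵉ (commᵉ (var 3) (var 4) ∙ var 5 ⁻¹) (var 1 ∙ var 2) ∙ conjᵉ (commᵉ (var 2) (var 5)) (var 1)))
                  (var 0 ∙ var 4 ∙ (var 1 ∙ var 5 ∙ (var 2 ∙ var 4) ∙ var 3) ⁻¹) refl)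
               (≈ᶠ-reflexive (cong₂ (λ s t → u · b · inv (s · t · powℕ a x)) (sym (powℕ-+ T z x)) (sym (powℕ-sucʳ b y))))

  normalForm-·powℕ : ∀ {g} → (∀ u → HasNormalForm u → HasNormalForm (u · g)) →
                     ∀ m u → HasNormalForm u → HasNormalForm (u · powℕ g m)
  normalForm-·powℕ step zero    u p = subst HasNormalForm (sym (++-identityʳ u)) p
  normalForm-·powℕ {g} step (suc m) u p =
    subst HasNormalForm (++-assoc u g (powℕ g m)) (normalForm-·powℕ step m (u · g) (step u p))

  normalForm-·inv : ∀ u g P → OrbitIn SpanGen (g · P) → HasNormalForm (u · P) → HasNormalForm (u · inv g)
  normalForm-·inv u g P orbit (x , y , z , gP) =
    x , y , z ,
    resp (prove (u ∷ P ∷ h ∷ g ∷ [])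
            (var 0 ∙ var 1 ∙ var 2 ⁻¹ ∙ conjᵉ ((var 3 ∙ var 1) ⁻¹) (var 2)) (var 0 ∙ var 3 ⁻¹ ∙ var 2 ⁻¹) refl)
      (mul gP (orbitIn-inv orbit h))
    where h = liftH (+ x , + y , + z)

  normalForm-·letter : ∀ u l → HasNormalForm u → HasNormalForm (u ++ l ∷ [])
  normalForm-·letter u (ga , false) = normalForm-·a u
  normalForm-·letter u (gb , false) = normalForm-·b u
  normalForm-·letter u (ga , true)  p =
    normalForm-·inv u a (powℕ a (suc n₀)) orbit-A (normalForm-·powℕ normalForm-·a (suc n₀) u p)
  normalForm-·letter u (gb , true)  p =
    normalForm-·inv u b (powℕ b (suc n₀)) orbit-B (normalForm-·powℕ normalForm-·b (suc n₀) u p)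

  normalForm-++ : ∀ w u → HasNormalForm u → HasNormalForm (u ++ w)
  normalForm-++ []      u p = subst HasNormalForm (sym (++-identityʳ u)) p
  normalForm-++ (l ∷ w) u p = subst HasNormalForm (++-assoc u (l ∷ []) w) (normalForm-++ w (u ++ l ∷ []) (normalForm-·letter u l p))

  InR⇒InSpan : ∀ w → InR n w → InSpan w
  InR⇒InSpan w pw with normalForm-++ w [] (0 , 0 , 0 , unit)
  ... | x , y , z , g =
    resp (prove (w ∷ h ∷ []) (var 0 ∙ var 1 ⁻¹ ∙ var 1) (var 0) refl)
      (mul g (mul (mul (subgrp-powℕ-∣ n∣z Tⁿ-∈) (subgrp-powℕ-∣ n∣y (orbitIn-∈ orbit-B)))
                  (subgrp-powℕ-∣ n∣x (orbitIn-∈ orbit-A))))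
    where
    h = liftH (+ x , + y , + z)
    InR-h : InR n h
    InR-h = InR-≈ (prove (w ∷ h ∷ []) ((var 0 ∙ var 1 ⁻¹) ⁻¹ ∙ var 0) (var 1) refl)
                  (InR-· (inv (w · inv h)) w (InR-inv (w · inv h) (InSpan⇒InR g)) pw)
    divisibility : (n ℕ.∣ x) × (n ℕ.∣ y) × (n ℕ.∣ z)
    divisibility =
      subst (λ g → (+ n ∣ᵤ proj₁ g) × (+ n ∣ᵤ proj₁ (proj₂ g)) × (+ n ∣ᵤ proj₂ (proj₂ g))) (evalH-liftH (+ x , + y , + z)) InR-h
    n∣x = proj₁ divisibility
    n∣y = proj₁ (proj₂ divisibility)
    n∣z = proj₂ (proj₂ divisibility)

  block : (ℕ → ℕ → Word) → ℕ → List Word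
  block f m = concatMap (λ i → map (f i) (upTo n)) (upTo m)

  length-block : ∀ f m → length (block f m) ≡ m ℕ.* n
  length-block f m =
    trans (length-concatMap _ n (λ i → trans (length-map (f i) (upTo n)) (length-upTo n)) (upTo m)) (cong (ℕ._* n) (length-upTo m))

  blockA blockB blockX blockY : List Word
  blockA = block (λ i k → conj A (powℕ b i · powℕ T k)) n
  blockB = block (λ i k → conj B (powℕ a i · powℕ T k)) n
  blockX = block (λ i k → conj X (powℕ a i · powℕ T k)) n₀
  blockY = concatMap (λ i → block (λ j k → conj Y (powℕ a i · powℕ b j · powℕ T k)) n₀) (upTo (suc n₀))

  rest : List Word
  rest = conj X (powℕ a n₀) ∷ blockY

  zGens-blocks : zGens n ≡ blockA ++ blockB ++ blockX ++ rest
  zGens-blocks = refl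

  Basis⇒∈blocks : ∀ {w} → Basis w → w ∈ blockA ++ blockB ++ blockX ++ rest
  Basis⇒∈blocks (basisA {i} {k} i<n k<n) =
    ∈-++⁺ˡ {ys = blockB ++ blockX ++ rest}
      (∈-concatMap-upTo (λ i → map (λ k → conj A (powℕ b i · powℕ T k)) (upTo n)) i<n
        (∈-map-upTo (λ k → conj A (powℕ b i · powℕ T k)) k<n))
  Basis⇒∈blocks (basisB {i} {k} i<n k<n) = ∈-++⁺ʳ blockA
    (∈-++⁺ˡ {ys = blockX ++ rest}
      (∈-concatMap-upTo (λ i → map (λ k → conj B (powℕ a i · powℕ T k)) (upTo n)) i<n
        (∈-map-upTo (λ k → conj B (powℕ a i · powℕ T k)) k<n)))
  Basis⇒∈blocks (basisX {i} {k} i<n₀ k<n) = ∈-++⁺ʳ blockA (∈-++⁺ʳ blockB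
    (∈-++⁺ˡ {ys = rest}
      (∈-concatMap-upTo (λ i → map (λ k → conj X (powℕ a i · powℕ T k)) (upTo n)) i<n₀
        (∈-map-upTo (λ k → conj X (powℕ a i · powℕ T k)) k<n))))
  Basis⇒∈blocks basisX' = ∈-++⁺ʳ blockA (∈-++⁺ʳ blockB (∈-++⁺ʳ blockX (here refl)))
  Basis⇒∈blocks (basisY {i} {j} {k} i<1+n₀ j<n₀ k<n) = ∈-++⁺ʳ blockA (∈-++⁺ʳ blockB (∈-++⁺ʳ blockX (there
    (∈-concatMap-upTo (λ i → concatMap (λ j → map (λ k → conj Y (powℕ a i · powℕ b j · powℕ T k)) (upTo n)) (upTo n₀)) i<1+n₀
      (∈-concatMap-upTo (λ j → map (λ k → conj Y (powℕ a i · powℕ b j · powℕ T k)) (upTo n)) j<n₀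
        (∈-map-upTo (λ k → conj Y (powℕ a i · powℕ b j · powℕ T k)) k<n))))))

  Basis⇒∈zGens : ∀ {w} → Basis w → w ∈ zGens n
  Basis⇒∈zGens {w} p = subst (w ∈_) (sym zGens-blocks) (Basis⇒∈blocks p)

  zGens-InR : All (InR n) (zGens n)
  zGens-InR = subst (All (InR n)) (sym zGens-blocks)
    (All.++⁺ {xs = blockA} (All-concatMap (λ i → All-map (λ k → InR-conj A (powℕ b i · powℕ T k) InR-A) (upTo n)) (upTo n))
    (All.++⁺ {xs = blockB} (All-concatMap (λ i → All-map (λ k → InR-conj B (powℕ a i · powℕ T k) InR-B) (upTo n)) (upTo n))
    (All.++⁺ {xs = blockX} (All-concatMap (λ i → All-map (λ k → InR-conj X (powℕ a i · powℕ T k) InR-X) (upTo n)) (upTo n₀))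
    (InR-conj X (powℕ a n₀) InR-X ∷
     All-concatMap (λ i → All-concatMap (λ j → All-map (λ k → InR-conj Y (powℕ a i · powℕ b j · powℕ T k) InR-Y)
                                                       (upTo n)) (upTo n₀)) (upTo (suc n₀))))))

  length-zGens : length (zGens n) ≡ n ^ 3 ℕ.+ 1
  length-zGens = begin
    length (zGens n)
      ≡⟨ cong length zGens-blocks ⟩
    length (blockA ++ blockB ++ blockX ++ rest)
      ≡⟨ length-++ blockA ⟩
    length blockA ℕ.+ length (blockB ++ blockX ++ rest)
      ≡⟨ cong (length blockA ℕ.+_) (trans (length-++ blockB) (cong (length blockB ℕ.+_) (length-++ blockX))) ⟩
    length blockA ℕ.+ (length blockB ℕ.+ (length blockX ℕ.+ suc (length blockY)))
      ≡⟨ cong₂ (λ p q → p ℕ.+ (q ℕ.+ (length blockX ℕ.+ suc (length blockY))))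
               (length-block (λ i k → conj A (powℕ b i · powℕ T k)) n) (length-block (λ i k → conj B (powℕ a i · powℕ T k)) n) ⟩
    n ℕ.* n ℕ.+ (n ℕ.* n ℕ.+ (length blockX ℕ.+ suc (length blockY)))
      ≡⟨ cong₂ (λ p q → n ℕ.* n ℕ.+ (n ℕ.* n ℕ.+ (p ℕ.+ suc q))) (length-block (λ i k → conj X (powℕ a i · powℕ T k)) n₀)
               (trans (length-concatMap (λ i → block (λ j k → conj Y (powℕ a i · powℕ b j · powℕ T k)) n₀) (n₀ ℕ.* n)
                                        (λ i → length-block (λ j k → conj Y (powℕ a i · powℕ b j · powℕ T k)) n₀) (upTo (suc n₀)))
                      (cong (ℕ._* (n₀ ℕ.* n)) (length-upTo (suc n₀)))) ⟩
    n ℕ.* n ℕ.+ (n ℕ.* n ℕ.+ (n₀ ℕ.* n ℕ.+ suc (suc n₀ ℕ.* (n₀ ℕ.* n))))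
      ≡⟨ count n₀ ⟩
    n ^ 3 ℕ.+ 1 ∎
    where
    open ≡-Reasoning
    count : ∀ m → (2 ℕ.+ m) ℕ.* (2 ℕ.+ m) ℕ.+
                  ((2 ℕ.+ m) ℕ.* (2 ℕ.+ m) ℕ.+ (m ℕ.* (2 ℕ.+ m) ℕ.+ suc ((1 ℕ.+ m) ℕ.* (m ℕ.* (2 ℕ.+ m)))))
                ≡ (2 ℕ.+ m) ℕ.* ((2 ℕ.+ m) ℕ.* ((2 ℕ.+ m) ℕ.* 1)) ℕ.+ 1
    count = ℕ-Solver.solve-∀

  IsModTerm : Word → Set
  IsModTerm w = Σ Word λ u → Σ Gen4 λ g → w ≡ conj (gen4 n g) u

  Basis⇒IsModTerm : ∀ {w} → Basis w → IsModTerm w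
  Basis⇒IsModTerm (basisA {i} {k} _ _)       = powℕ b i · powℕ T k , gAn , refl
  Basis⇒IsModTerm (basisB {i} {k} _ _)       = powℕ a i · powℕ T k , gBn , refl
  Basis⇒IsModTerm (basisX {i} {k} _ _)       = powℕ a i · powℕ T k , gaT , refl
  Basis⇒IsModTerm basisX'                    = powℕ a n₀ , gaT , refl
  Basis⇒IsModTerm (basisY {i} {j} {k} _ _ _) = powℕ a i · powℕ b j · powℕ T k , gbT , refl

  modTerms : ∀ {L} → All (λ p → IsModTerm (proj₁ p)) L →
             Σ (List (Word × Gen4 × Bool)) λ ts → prodSigned L ≈ᶠ prodW (map (modTerm n) ts)
  modTerms [] = [] , ≈refl
  modTerms {(_ , s) ∷ _} ((u , g , refl) ∷ qs) with modTerms qs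
  ... | ts , e = (u , g , s) ∷ ts , ·-cong (signed-modTerm s) e
    where
    signed-modTerm : ∀ s → signed (conj (gen4 n g) u , s) ≈ᶠ modTerm n (u , g , s)
    signed-modTerm false = ≈refl
    signed-modTerm true  = ≈sym (conj-inv (gen4 n g) u)

  module-generation : ∀ w → InR n w → Σ (List (Word × Gen4 × Bool)) λ ts → w ≡[RR n ] prodW (map (modTerm n) ts)
  module-generation w pw = from-flattening (flatten (InR⇒InSpan w pw))
    where
    from-flattening : Flattening Basis w → Σ (List (Word × Gen4 × Bool)) λ ts → w ≡[RR n ] prodW (map (modTerm n) ts)
    from-flattening (L , bL , e) = let (ts , e') = modTerms (All.map Basis⇒IsModTerm bL) in ts , un~ (~-trans e (~-≈ e'))

  z-generation : ∀ w → InR n w →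
                 Σ (List ℤ) λ cs → (length cs ≡ length (zGens n)) × (w ≡[RR n ] zComb (zGens n) cs)
  z-generation w pw = from-flattening (flatten (InR⇒InSpan w pw))
    where
    from-flattening : Flattening Basis w → Σ (List ℤ) λ cs → (length cs ≡ length (zGens n)) × (w ≡[RR n ] zComb (zGens n) cs)
    from-flattening (L , bL , e) =
      let (cs , len , e') = zCombination (zGens n) zGens-InR L (All.map Basis⇒∈zGens bL) in cs , len , un~ (~-trans e e')

proposition2p12 : (n : ℕ) → 2 ≤ n →
    ((w : Word) → InR n w →
      Σ (List (Word × Gen4 × Bool)) λ ts → w ≡[RR n ] prodW (map (modTerm n) ts))
    × (length (zGens n) ≡ n ^ 3 ℕ.+ 1)
    × ((w : Word) → InR n w →
      Σ (List ℤ) λ cs → (length cs ≡ length (zGens n)) × (w ≡[RR n ] zComb (zGens n) cs))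
proposition2p12 (suc (suc n₀)) (s≤s (s≤s z≤n)) = module-generation , length-zGens , z-generation
  where open Generation n₀
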